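{- Let $M$ be a closed term. For each tight typing $\vdash^{w}M:\mathtt{b}$ there exists $k\in\mathbb{N}$ such that $\|\mathtt{b}\|\le\mathcal{P}_k(M)$ and $w\le\mathcal{E}_k(M)$.
   Context: Terms: values $V ::= x \mid \lambda x.M$; terms $M ::= V \mid VV \mid M\oplus M \mid \mathtt{let}\ x = M\ \mathtt{in}\ M$; $M\{V/x\}$ is capture-avoiding substitution. A multidistribution on terms is a finite multiset $\langle p_iM_i\rangle_{i\in I}$ with $p_i\in(0,1]$, $\sum_ip_i\le1$; $\sqcup$ is multiset union and $q\cdot\langle p_iM_i\rangle=\langle (qp_i)M_i\rangle$. One-step reduction: $(\lambda x.M)V\to\langle 1\,M\{V/x\}\rangle$; $\mathtt{let}\ x=V\ \mathtt{in}\ M\to\langle 1\,M\{V/x\}\rangle$; $M\oplus N\to\langle\tfrac12 M,\tfrac12 N\rangle$; if $N\to\langle p_iN_i\rangle_{i\in I}$ then $\mathtt{let}\ x=N\ \mathtt{in}\ M\to\langle p_i(\mathtt{let}\ x=N_i\ \mathtt{in}\ M)\rangle_{i\in I}$. (Closed terms that do not reduce are exactly values.) Lifting to multidistributions of closed terms: $\langle p_iM_i\rangle_{i\in I}\Rightarrow\bigsqcup_i p_i\cdot\mathbf{m}_i$ where $\mathbf{m}_i=\langle 1M_i\rangle$ if $M_i$ is a value and $M_i\to\mathbf{m}_i$ otherwise. For closed $M$ let $\langle 1M\rangle=\mathbf{m}_0\Rightarrow\mathbf{m}_1\Rightarrow\cdots$; $\mathcal{P}_k(M)$ is the sum of the probabilities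 of the values occurring in $\mathbf{m}_k$, and $\mathcal{E}_k(M)=\sum_{j=0}^{k-1}(1-\mathcal{P}_j(M))$. Types: arrow types $\mathtt{A} ::= \mathcal{M}\to \mathtt{a}$; intersection types $\mathcal{M} ::= [q_1\cdot \mathtt{A}_1,\dots,q_n\cdot\mathtt{A}_n]$ ($n\ge0$, scale factors $q_i\in(0,1]\cap\mathbb{Q}$); type distributions $\mathtt{a} ::= \langle p_1\mathcal{M}_1,\dots,p_n\mathcal{M}_n\rangle$ ($n\ge0$, $p_i\in(0,1]$, $\sum p_i\le1$), with norm $\|\mathtt{a}\|=\sum_i p_i$; $\mathbf{0}$ is the empty type distribution. Scaling: $u\cdot[q_i\cdot\mathtt{A}_i]_i=[(uq_i)\cdot \mathtt{A}_i]_i$, $u\cdot\langle p_i\mathcal{M}_i\rangle_i=\langle (up_i)\mathcal{M}_i\rangle_i$; $\uplus,\sqcup$ multiset unions. Typing contexts map variables to intersection types (finitely many nonempty), pointwise $\uplus$ and scaling. Rules for $\Gamma\vdash^{w}M:\tau$ ($w\in\mathbb{Q}$): (Var) $x:\mathcal{M}\vdash^0 x:\mathcal{M}$. (Zero) $\vdash^0 M:\mathbf{0}$. (@) from $\Gamma\vdash^{w}V:[1\cdot(\mathcal{M}\to\mathtt{b})]$, $\Delta\vdash^{v}W:\mathcal{M}$ infer $\Gamma\uplus\Delta\vdash^{w+v}VW:\mathtt{b}$. ($\oplus$) from $\Gamma\vdash^{w}M:\mathtt{a}$, $\Delta\vdash^{v}N:\mathtt{b}$ infer $\tfrac12\cdot\Gamma\uplus\tfrac12\cdot\Delta\vdash^{\frac12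 w+\frac12 v+1}M\oplus N:\tfrac12\mathtt{a}\sqcup\tfrac12\mathtt{b}$. ($\lambda$) from $\Gamma,x:\mathcal{M}\vdash^{w}M:\mathtt{b}$ infer $\Gamma\vdash^{w+1}\lambda x.M:\mathcal{M}\to\mathtt{b}$. (let) from $\Gamma\vdash^{v}N:\langle p_k\mathcal{M}_k\rangle_{k\in K}$ and $\Delta_k,x:\mathcal{M}_k\vdash^{w_k}M:\mathtt{b}_k$ ($k\in K$) infer $\Gamma\uplus_{k}p_k\cdot\Delta_k\vdash^{\sum_k p_kw_k+v+1}\mathtt{let}\ x=N\ \mathtt{in}\ M:\bigsqcup_k p_k\mathtt{b}_k$. (Val) from $\Gamma\vdash^{w}V:\mathcal{M}$ infer $\Gamma\vdash^{w}V:\langle 1\mathcal{M}\rangle$. (!) for finite possibly empty $I$, from $\Gamma_i\vdash^{w_i}V:\mathtt{A}_i$ and scale factors $q_i$ infer $\uplus_i q_i\cdot\Gamma_i\vdash^{\sum_i q_iw_i}V:[q_i\cdot\mathtt{A}_i]_{i\in I}$. A type distribution is tight if it has the form $\langle q_k[\,]\rangle_{k\in K}$ ($K$ possibly empty); a tight typing is a derivable judgement $\vdash^{w}M:\mathtt{b}$ (empty context) with $\mathtt{b}$ tight. -}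

module Defs where

open import Data.Nat using (ℕ; zero; suc)
open import Data.Fin using (Fin; zero; suc)
open import Data.List using (List; []; _∷_; _++_; map; concatMap; foldr)
open import Data.List.Relation.Unary.All using (All)
open import Data.List.Relation.Binary.Permutation.Homogeneous using (Permutation)
open import Data.Vec using (Vec; []; _∷_; replicate; zipWith)
import Data.Vec.Relation.Binary.Pointwise.Inductive as VP
open import Data.Product using (_×_; _,_; proj₁; proj₂)
open import Data.Rational using (ℚ; 0ℚ; 1ℚ; ½; _+_; _*_; _-_; _≤_; _<_)
open import Relation.Binary.PropositionalEquality using (_≡_)

mutual
  data Val (n : ℕ) : Set where
    var : Fin n → Val n
    lam : Tm (suc n) → Val n

  data Tm (n : ℕ) : Set where
    val  : Val n → Tm n
    app  : Val n → Val n → Tm n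
    _⊕_  : Tm n → Tm n → Tm n
    letin : Tm n → Tm (suc n) → Tm n

ext : ∀ {n m} → (Fin n → Fin m) → Fin (suc n) → Fin (suc m)
ext ρ zero = zero
ext ρ (suc i) = suc (ρ i)

mutual
  renV : ∀ {n m} → (Fin n → Fin m) → Val n → Val m
  renV ρ (var i) = var (ρ i)
  renV ρ (lam M) = lam (renT (ext ρ) M)

  renT : ∀ {n m} → (Fin n → Fin m) → Tm n → Tm m
  renT ρ (val V) = val (renV ρ V)
  renT ρ (app V W) = app (renV ρ V) (renV ρ W)
  renT ρ (M ⊕ N) = renT ρ M ⊕ renT ρ N
  renT ρ (letin N M) = letin (renT ρ N) (renT (ext ρ) M)

exts : ∀ {n m} → (Fin n → Val m) → Fin (suc n) → Val (suc m)
exts σ zero = var zero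
exts σ (suc i) = renV suc (σ i)

mutual
  subV : ∀ {n m} → (Fin n → Val m) → Val n → Val m
  subV σ (var i) = σ i
  subV σ (lam M) = lam (subT (exts σ) M)

  subT : ∀ {n m} → (Fin n → Val m) → Tm n → Tm m
  subT σ (val V) = val (subV σ V)
  subT σ (app V W) = app (subV σ V) (subV σ W)
  subT σ (M ⊕ N) = subT σ M ⊕ subT σ N
  subT σ (letin N M) = letin (subT σ N) (subT (exts σ) M)

single : ∀ {n} → Val n → Fin (suc n) → Val n
single V zero = V
single V (suc i) = var i

_[_] : ∀ {n} → Tm (suc n) → Val n → Tm n
M [ V ] = subT (single V) M

MDist : Set
MDist = List (ℚ × Tm 0)

scaleM : ℚ → MDist → MDist
scaleM q = map (λ e → (q * proj₁ e , proj₂ e))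

-- The one-step reduction M → m of a closed term, together with the
-- lifting convention m = ⟨1 M⟩ when M is a value.  (On closed terms the
-- reduction relation is deterministic and total on non-values, so it is
-- a function; each clause is one rule of the paper.)
stepC : Tm 0 → MDist
stepC (val V) = (1ℚ , val V) ∷ []
stepC (app (var ()) W)
stepC (app (lam M) W) = (1ℚ , M [ W ]) ∷ []
stepC (M ⊕ N) = (½ , M) ∷ (½ , N) ∷ []
stepC (letin (val V) M) = (1ℚ , M [ V ]) ∷ []
stepC (letin (app V W) M) = map (λ e → (proj₁ e , letin (proj₂ e) M)) (stepC (app V W))
stepC (letin (N₁ ⊕ N₂) M) = map (λ e → (proj₁ e , letin (proj₂ e) M)) (stepC (N₁ ⊕ N₂))
stepC (letin (letin N₁ N₂) M) = map (λ e → (proj₁ e , letin (proj₂ e) M)) (stepC (letin N₁ N₂))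

liftStep : MDist → MDist
liftStep = concatMap (λ e → scaleM (proj₁ e) (stepC (proj₂ e)))

mseq : Tm 0 → ℕ → MDist
mseq M zero = (1ℚ , M) ∷ []
mseq M (suc k) = liftStep (mseq M k)

valueMass : MDist → ℚ
valueMass [] = 0ℚ
valueMass ((p , val V) ∷ m) = p + valueMass m
valueMass ((p , app _ _) ∷ m) = valueMass m
valueMass ((p , _ ⊕ _) ∷ m) = valueMass m
valueMass ((p , letin _ _) ∷ m) = valueMass m

𝒫 : ℕ → Tm 0 → ℚ
𝒫 k M = valueMass (mseq M k)

ℰ : ℕ → Tm 0 → ℚ
ℰ zero M = 0ℚ
ℰ (suc k) M = ℰ k M + (1ℚ - 𝒫 k M)

-- Types (raw syntax: lists read as multisets, up to _≈_ below)

data Arr : Set where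
  _⟶_ : List (ℚ × Arr) → List (ℚ × List (ℚ × Arr)) → Arr

Inter : Set
Inter = List (ℚ × Arr)

TDist : Set
TDist = List (ℚ × Inter)

norm : TDist → ℚ
norm = foldr (λ e r → proj₁ e + r) 0ℚ

scaleI : ℚ → Inter → Inter
scaleI u = map (λ e → (u * proj₁ e , proj₂ e))

scaleD : ℚ → TDist → TDist
scaleD u = map (λ e → (u * proj₁ e , proj₂ e))

InUnit : ℚ → Set
InUnit q = (0ℚ < q) × (q ≤ 1ℚ)

mutual
  data WFA : Arr → Set where
    wfA : ∀ {𝓜 a} → WFI 𝓜 → WFD a → norm a ≤ 1ℚ → WFA (𝓜 ⟶ a)

  data WFI : Inter → Set where
    []  : WFI []
    _∷_ : ∀ {q A 𝓜} → InUnit q × WFA A → WFI 𝓜 → WFI ((q , A) ∷ 𝓜)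

  data WFD : TDist → Set where
    []  : WFD []
    _∷_ : ∀ {p 𝓜 a} → InUnit p × WFI 𝓜 → WFD a → WFD ((p , 𝓜) ∷ a)

mutual
  data _≈A_ : Arr → Arr → Set where
    ⟶≈ : ∀ {𝓜 𝓝 a b} → 𝓜 ≈I 𝓝 → a ≈D b → (𝓜 ⟶ a) ≈A (𝓝 ⟶ b)

  data _≈I_ (𝓜 𝓝 : Inter) : Set where
    permI : Permutation (λ e f → (proj₁ e ≡ proj₁ f) × (proj₂ e ≈A proj₂ f)) 𝓜 𝓝 → 𝓜 ≈I 𝓝

  data _≈D_ (a b : TDist) : Set where
    permD : Permutation (λ e f → (proj₁ e ≡ proj₁ f) × (proj₂ e ≈I proj₂ f)) a b → a ≈D b

Ctx : ℕ → Set
Ctx n = Vec Inter n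

∅ : ∀ {n} → Ctx n
∅ = replicate _ []

_⊎_ : ∀ {n} → Ctx n → Ctx n → Ctx n
_⊎_ = zipWith _++_

_·_ : ∀ {n} → ℚ → Ctx n → Ctx n
u · Γ = Data.Vec.map (scaleI u) Γ

_≈C_ : ∀ {n} → Ctx n → Ctx n → Set
_≈C_ = VP.Pointwise _≈I_

only : ∀ {n} → Fin n → Inter → Ctx n
only {suc n} zero 𝓜 = 𝓜 ∷ ∅
only {suc n} (suc i) 𝓜 = [] ∷ only i 𝓜

mutual
  data _⊢A_∣_∶_ {n} : Ctx n → ℚ → Val n → Arr → Set where
    ⊢λ : ∀ {Γ w M 𝓜 b} →
         (𝓜 ∷ Γ) ⊢ w ∣ M ∶ b →
         Γ ⊢A (w + 1ℚ) ∣ lam M ∶ (𝓜 ⟶ b)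
    convA : ∀ {Γ Γ' w V A A'} → Γ ⊢A w ∣ V ∶ A → Γ ≈C Γ' → A ≈A A' →
            Γ' ⊢A w ∣ V ∶ A'

  data _⊢I_∣_∶_ {n} : Ctx n → ℚ → Val n → Inter → Set where
    ⊢var : ∀ {x 𝓜} → WFI 𝓜 → only x 𝓜 ⊢I 0ℚ ∣ var x ∶ 𝓜
    ⊢! : ∀ {Γ w V 𝓜} → Bang Γ w V 𝓜 → Γ ⊢I w ∣ V ∶ 𝓜
    convI : ∀ {Γ Γ' w V 𝓜 𝓜'} → Γ ⊢I w ∣ V ∶ 𝓜 → Γ ≈C Γ' → 𝓜 ≈I 𝓜' →
            Γ' ⊢I w ∣ V ∶ 𝓜'

  -- premises of rule (!) for a finite family I, accumulated
  -- Bang (⊎ᵢ qᵢ·Γᵢ) (Σᵢ qᵢwᵢ) V [qᵢ·Aᵢ]ᵢ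
  data Bang {n} : Ctx n → ℚ → Val n → Inter → Set where
    bnil  : ∀ {V} → Bang ∅ 0ℚ V []
    bcons : ∀ {Γ Δ w v V A 𝓜} (q : ℚ) → InUnit q →
            Γ ⊢A w ∣ V ∶ A → Bang Δ v V 𝓜 →
            Bang ((q · Γ) ⊎ Δ) (q * w + v) V ((q , A) ∷ 𝓜)

  data _⊢_∣_∶_ {n} : Ctx n → ℚ → Tm n → TDist → Set where
    ⊢zero : ∀ {M} → ∅ ⊢ 0ℚ ∣ M ∶ []
    ⊢app : ∀ {Γ Δ w v V W 𝓜 b} →
         Γ ⊢I w ∣ V ∶ ((1ℚ , (𝓜 ⟶ b)) ∷ []) →
         Δ ⊢I v ∣ W ∶ 𝓜 →
         (Γ ⊎ Δ) ⊢ (w + v) ∣ app V W ∶ b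
    ⊢⊕ : ∀ {Γ Δ w v M N a b} →
         Γ ⊢ w ∣ M ∶ a → Δ ⊢ v ∣ N ∶ b →
         ((½ · Γ) ⊎ (½ · Δ)) ⊢ (½ * w + ½ * v + 1ℚ) ∣ M ⊕ N ∶ (scaleD ½ a ++ scaleD ½ b)
    ⊢let : ∀ {Γ Θ v u N M a c} →
           Γ ⊢ v ∣ N ∶ a → Branches Θ u M a c →
           (Γ ⊎ Θ) ⊢ (u + v + 1ℚ) ∣ letin N M ∶ c
    ⊢val : ∀ {Γ w V 𝓜} → Γ ⊢I w ∣ V ∶ 𝓜 → Γ ⊢ w ∣ val V ∶ ((1ℚ , 𝓜) ∷ [])
    conv : ∀ {Γ Γ' w M a a'} → Γ ⊢ w ∣ M ∶ a → Γ ≈C Γ' → a ≈D a' →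
           Γ' ⊢ w ∣ M ∶ a'

  -- premises of rule (let) for the body, one per component pₖ𝓜ₖ of the
  -- type of N:  Branches (⊎ₖ pₖ·Δₖ) (Σₖ pₖwₖ) M ⟨pₖ𝓜ₖ⟩ₖ (⊔ₖ pₖbₖ)
  data Branches {n} : Ctx n → ℚ → Tm (suc n) → TDist → TDist → Set where
    brnil  : ∀ {M} → Branches ∅ 0ℚ M [] []
    brcons : ∀ {Δ Θ w u M p 𝓜 a b c} →
             (𝓜 ∷ Δ) ⊢ w ∣ M ∶ b → Branches Θ u M a c →
             Branches ((p · Δ) ⊎ Θ) (p * w + u) M ((p , 𝓜) ∷ a) (scaleD p b ++ c)

Tight : TDist → Set
Tight = All (λ e → proj₂ e ≡ [])

-- The argument is a quantitative subject reduction.  If a closed non-value M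
-- is typed with weight w and a non-empty type b, its one-step reducts Mᵢ, reached
-- with probabilities pᵢ, have typings with weights wᵢ and types bᵢ such that
-- b ≈ ⊔ᵢ pᵢbᵢ and w ≤ 1 + Σᵢ pᵢwᵢ, by strictly smaller derivations; the β and
-- let-value cases rest on a substitution lemma in which weights add up and sizes
-- do not exceed the sum.  By induction on derivation size every tight typing
-- ⊢ʷ M : b is then attained, i.e. ‖b‖ ≤ 𝒫ₖ(M) and w ≤ ℰₖ(M) for some k: a tight
-- value has weight 0 and ‖b‖ ≤ 1, and for a non-value the bounds of the reducts
-- combine linearly (𝒫 and ℰ of multidistributions are additive and homogeneous)
-- while the step itself adds the mass 1 of M to ℰ.

module Submission where

open import Defs
open import Data.Nat as N using (ℕ; zero; suc; z≤n; s≤s)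
import Data.Nat.Properties as NP
open import Data.Fin using (Fin; zero; suc)
open import Data.List as L using (List; []; _∷_; _++_)
open import Data.List.Properties using (++-assoc; ++-identityʳ; map-++)
open import Data.List.Relation.Unary.All using (All; []; _∷_)
open import Data.List.Relation.Binary.Pointwise using (Pointwise; []; _∷_)
open import Data.List.Relation.Binary.Permutation.Homogeneous using (Permutation; refl; prep; swap; trans)
import Data.List.Relation.Binary.Permutation.Setoid.Properties as PermProperties
open import Data.Vec using ([]; _∷_)
import Data.Vec.Relation.Binary.Pointwise.Inductive as VP
open import Data.Product using (∃-syntax; _×_; _,_; proj₁; proj₂; Σ; ∃)
open import Data.Rational as Q using (ℚ; _≤_; 0ℚ; 1ℚ; ½)
import Data.Rational.Properties as QP
open import Data.Rational.Solver using (module +-*-Solver)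
open import Relation.Binary.PropositionalEquality as Eq using (_≡_; cong; cong₂)
open import Relation.Binary.Bundles using (Setoid)
open import Algebra.Bundles using (CommutativeMonoid)
import Algebra.Properties.CommutativeSemigroup as CommSemigroupProperties

open +-*-Solver using (solve; _:+_; _:*_; _:-_; _:=_; con)
module ℕ+ = CommSemigroupProperties NP.+-commutativeSemigroup
module ℚ+ = CommSemigroupProperties (CommutativeMonoid.commutativeSemigroup QP.+-0-commutativeMonoid)

_≈[A]_ : ℚ × Arr → ℚ × Arr → Set
e ≈[A] f = (proj₁ e ≡ proj₁ f) × (proj₂ e ≈A proj₂ f)

_≈[I]_ : ℚ × Inter → ℚ × Inter → Set
e ≈[I] f = (proj₁ e ≡ proj₁ f) × (proj₂ e ≈I proj₂ f)

mutual
  ≈A-refl : ∀ A → A ≈A A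
  ≈A-refl (𝓜 ⟶ a) = ⟶≈ (≈I-refl 𝓜) (≈D-refl a)

  ≈I-refl : ∀ 𝓜 → 𝓜 ≈I 𝓜
  ≈I-refl 𝓜 = permI (refl (≈[A]-pointwise-refl 𝓜))

  ≈[A]-pointwise-refl : ∀ 𝓜 → Pointwise _≈[A]_ 𝓜 𝓜
  ≈[A]-pointwise-refl [] = []
  ≈[A]-pointwise-refl ((q , A) ∷ 𝓜) = (Eq.refl , ≈A-refl A) ∷ ≈[A]-pointwise-refl 𝓜

  ≈D-refl : ∀ a → a ≈D a
  ≈D-refl a = permD (refl (≈[I]-pointwise-refl a))

  ≈[I]-pointwise-refl : ∀ a → Pointwise _≈[I]_ a a
  ≈[I]-pointwise-refl [] = []
  ≈[I]-pointwise-refl ((p , 𝓜) ∷ a) = (Eq.refl , ≈I-refl 𝓜) ∷ ≈[I]-pointwise-refl a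

mutual
  ≈A-sym : ∀ {A B} → A ≈A B → B ≈A A
  ≈A-sym (⟶≈ i d) = ⟶≈ (≈I-sym i) (≈D-sym d)

  ≈I-sym : ∀ {𝓜 𝓝} → 𝓜 ≈I 𝓝 → 𝓝 ≈I 𝓜
  ≈I-sym (permI p) = permI (≈[A]-perm-sym p)

  ≈D-sym : ∀ {a b} → a ≈D b → b ≈D a
  ≈D-sym (permD p) = permD (≈[I]-perm-sym p)

  ≈[A]-perm-sym : ∀ {xs ys} → Permutation _≈[A]_ xs ys → Permutation _≈[A]_ ys xs
  ≈[A]-perm-sym (refl x) = refl (≈[A]-pointwise-sym x)
  ≈[A]-perm-sym (prep (e , a) p) = prep (Eq.sym e , ≈A-sym a) (≈[A]-perm-sym p)
  ≈[A]-perm-sym (swap (e , a) (e' , a') p) = swap (Eq.sym e' , ≈A-sym a') (Eq.sym e , ≈A-sym a) (≈[A]-perm-sym p)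
  ≈[A]-perm-sym (trans p q) = trans (≈[A]-perm-sym q) (≈[A]-perm-sym p)

  ≈[A]-pointwise-sym : ∀ {xs ys} → Pointwise _≈[A]_ xs ys → Pointwise _≈[A]_ ys xs
  ≈[A]-pointwise-sym [] = []
  ≈[A]-pointwise-sym ((e , a) ∷ x) = (Eq.sym e , ≈A-sym a) ∷ ≈[A]-pointwise-sym x

  ≈[I]-perm-sym : ∀ {xs ys} → Permutation _≈[I]_ xs ys → Permutation _≈[I]_ ys xs
  ≈[I]-perm-sym (refl x) = refl (≈[I]-pointwise-sym x)
  ≈[I]-perm-sym (prep (e , a) p) = prep (Eq.sym e , ≈I-sym a) (≈[I]-perm-sym p)
  ≈[I]-perm-sym (swap (e , a) (e' , a') p) = swap (Eq.sym e' , ≈I-sym a') (Eq.sym e , ≈I-sym a) (≈[I]-perm-sym p)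
  ≈[I]-perm-sym (trans p q) = trans (≈[I]-perm-sym q) (≈[I]-perm-sym p)

  ≈[I]-pointwise-sym : ∀ {xs ys} → Pointwise _≈[I]_ xs ys → Pointwise _≈[I]_ ys xs
  ≈[I]-pointwise-sym [] = []
  ≈[I]-pointwise-sym ((e , a) ∷ x) = (Eq.sym e , ≈I-sym a) ∷ ≈[I]-pointwise-sym x

≈I-trans : ∀ {𝓜 𝓝 𝓞} → 𝓜 ≈I 𝓝 → 𝓝 ≈I 𝓞 → 𝓜 ≈I 𝓞
≈I-trans (permI p) (permI q) = permI (trans p q)

≈D-trans : ∀ {a b c} → a ≈D b → b ≈D c → a ≈D c
≈D-trans (permD p) (permD q) = permD (trans p q)

≈A-trans : ∀ {A B C} → A ≈A B → B ≈A C → A ≈A C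
≈A-trans (⟶≈ i d) (⟶≈ i' d') = ⟶≈ (≈I-trans i i') (≈D-trans d d')

≈[A]-setoid : Setoid _ _
≈[A]-setoid = record { Carrier = ℚ × Arr ; _≈_ = _≈[A]_ ; isEquivalence = record
  { refl = λ {x} → Eq.refl , ≈A-refl (proj₂ x)
  ; sym = λ { (e , a) → Eq.sym e , ≈A-sym a }
  ; trans = λ { (e , a) (e' , a') → Eq.trans e e' , ≈A-trans a a' } } }

≈[I]-setoid : Setoid _ _
≈[I]-setoid = record { Carrier = ℚ × Inter ; _≈_ = _≈[I]_ ; isEquivalence = record
  { refl = λ {x} → Eq.refl , ≈I-refl (proj₂ x)
  ; sym = λ { (e , a) → Eq.sym e , ≈I-sym a }
  ; trans = λ { (e , a) (e' , a') → Eq.trans e e' , ≈I-trans a a' } } }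

module PermA = PermProperties ≈[A]-setoid
module PermI = PermProperties ≈[I]-setoid

≈I-reflexive : ∀ {𝓜 𝓝} → 𝓜 ≡ 𝓝 → 𝓜 ≈I 𝓝
≈I-reflexive {𝓜} Eq.refl = ≈I-refl 𝓜

≈D-reflexive : ∀ {a b} → a ≡ b → a ≈D b
≈D-reflexive {a} Eq.refl = ≈D-refl a

≈I-++ : ∀ {a b c d} → a ≈I b → c ≈I d → (a ++ c) ≈I (b ++ d)
≈I-++ (permI p) (permI q) = permI (PermA.++⁺ p q)

≈D-++ : ∀ {a b c d} → a ≈D b → c ≈D d → (a ++ c) ≈D (b ++ d)
≈D-++ (permD p) (permD q) = permD (PermI.++⁺ p q)

≈I-++-comm : ∀ a b → (a ++ b) ≈I (b ++ a)
≈I-++-comm a b = permI (PermA.++-comm a b)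

≈I-interchange : ∀ a b c d → ((a ++ b) ++ (c ++ d)) ≈I ((a ++ c) ++ (b ++ d))
≈I-interchange a b c d = Eq.subst₂ _≈I_ (Eq.sym (++-assoc a b (c ++ d))) (Eq.sym (++-assoc a c (b ++ d)))
  (permI (PermA.++⁺ˡ a (PermA.shifts b c)))

≈I-[] : ∀ {𝓜} → [] ≈I 𝓜 → 𝓜 ≡ []
≈I-[] {[]} _ = Eq.refl
≈I-[] {_ ∷ _} (permI p) with PermA.xs↭ys⇒|xs|≡|ys| p
... | ()

-- scaleI, scaleD and scaleM unfold to scale, so its lemmas serve all three.
scale : ∀ {X : Set} → ℚ → List (ℚ × X) → List (ℚ × X)
scale u = L.map (λ e → (u Q.* proj₁ e , proj₂ e))

scale-++ : ∀ {X : Set} p (a b : List (ℚ × X)) → scale p (a ++ b) ≡ scale p a ++ scale p b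
scale-++ p = map-++ _

scale-scale : ∀ {X : Set} p q (a : List (ℚ × X)) → scale p (scale q a) ≡ scale (p Q.* q) a
scale-scale p q [] = Eq.refl
scale-scale p q ((r , A) ∷ a) = cong₂ _∷_ (cong (_, A) (Eq.sym (QP.*-assoc p q r))) (scale-scale p q a)

scale-1 : ∀ {X : Set} (a : List (ℚ × X)) → scale 1ℚ a ≡ a
scale-1 [] = Eq.refl
scale-1 ((r , A) ∷ a) = cong₂ _∷_ (cong (_, A) (QP.*-identityˡ r)) (scale-1 a)

≈C-refl : ∀ {n} (Γ : Ctx n) → Γ ≈C Γ
≈C-refl Γ = VP.refl (≈I-refl _)

≈C-sym : ∀ {n} {Γ Δ : Ctx n} → Γ ≈C Δ → Δ ≈C Γ
≈C-sym = VP.sym ≈I-sym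

≈C-trans : ∀ {n} {Γ Δ Θ : Ctx n} → Γ ≈C Δ → Δ ≈C Θ → Γ ≈C Θ
≈C-trans = VP.trans ≈I-trans

≈C-reflexive : ∀ {n} {Γ Δ : Ctx n} → Γ ≡ Δ → Γ ≈C Δ
≈C-reflexive {Γ = Γ} Eq.refl = ≈C-refl Γ

≈C-closed : (Γ Δ : Ctx 0) → Γ ≈C Δ
≈C-closed [] [] = VP.[]

⊎-cong : ∀ {n} {Γ Γ' Δ Δ' : Ctx n} → Γ ≈C Γ' → Δ ≈C Δ' → (Γ ⊎ Δ) ≈C (Γ' ⊎ Δ')
⊎-cong VP.[] VP.[] = VP.[]
⊎-cong (x VP.∷ p) (y VP.∷ q) = ≈I-++ x y VP.∷ ⊎-cong p q

⊎-identityˡ : ∀ {n} (Γ : Ctx n) → (∅ ⊎ Γ) ≡ Γ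
⊎-identityˡ [] = Eq.refl
⊎-identityˡ (x ∷ Γ) = cong (x ∷_) (⊎-identityˡ Γ)

⊎-identityʳ : ∀ {n} (Γ : Ctx n) → (Γ ⊎ ∅) ≡ Γ
⊎-identityʳ [] = Eq.refl
⊎-identityʳ (x ∷ Γ) = cong₂ _∷_ (++-identityʳ x) (⊎-identityʳ Γ)

⊎-assoc : ∀ {n} (Γ Δ Θ : Ctx n) → ((Γ ⊎ Δ) ⊎ Θ) ≡ (Γ ⊎ (Δ ⊎ Θ))
⊎-assoc [] [] [] = Eq.refl
⊎-assoc (x ∷ Γ) (y ∷ Δ) (z ∷ Θ) = cong₂ _∷_ (++-assoc x y z) (⊎-assoc Γ Δ Θ)

⊎-comm : ∀ {n} (Γ Δ : Ctx n) → (Γ ⊎ Δ) ≈C (Δ ⊎ Γ)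
⊎-comm [] [] = VP.[]
⊎-comm (x ∷ Γ) (y ∷ Δ) = ≈I-++-comm x y VP.∷ ⊎-comm Γ Δ

⊎-interchange : ∀ {n} (Γ Δ Θ Ξ : Ctx n) → ((Γ ⊎ Δ) ⊎ (Θ ⊎ Ξ)) ≈C ((Γ ⊎ Θ) ⊎ (Δ ⊎ Ξ))
⊎-interchange [] [] [] [] = VP.[]
⊎-interchange (a ∷ Γ) (b ∷ Δ) (c ∷ Θ) (d ∷ Ξ) = ≈I-interchange a b c d VP.∷ ⊎-interchange Γ Δ Θ Ξ

⊎-swap-cong : ∀ {n} (A B C C' : Ctx n) → C ≈C C' → (A ⊎ (B ⊎ C)) ≈C (B ⊎ (A ⊎ C'))
⊎-swap-cong A B C C' p = ≈C-trans (≈C-reflexive (Eq.sym (⊎-assoc A B C)))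
  (≈C-trans (⊎-cong (⊎-comm A B) p) (≈C-reflexive (⊎-assoc B A C')))

·-distrib-⊎ : ∀ {n} u (Γ Δ : Ctx n) → (u · (Γ ⊎ Δ)) ≡ ((u · Γ) ⊎ (u · Δ))
·-distrib-⊎ u [] [] = Eq.refl
·-distrib-⊎ u (x ∷ Γ) (y ∷ Δ) = cong₂ _∷_ (scale-++ u x y) (·-distrib-⊎ u Γ Δ)

·-∅ : ∀ {n} u → (u · ∅ {n}) ≡ ∅
·-∅ {zero} u = Eq.refl
·-∅ {suc n} u = cong ([] ∷_) (·-∅ {n} u)

·-· : ∀ {n} u v (Γ : Ctx n) → (u · (v · Γ)) ≡ ((u Q.* v) · Γ)
·-· u v [] = Eq.refl
·-· u v (x ∷ Γ) = cong₂ _∷_ (scale-scale u v x) (·-· u v Γ)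

only-[] : ∀ {n} (x : Fin n) → only x [] ≡ ∅
only-[] {suc n} zero = Eq.refl
only-[] {suc n} (suc x) = cong ([] ∷_) (only-[] x)

only-++ : ∀ {n} (x : Fin n) a b → only x (a ++ b) ≡ (only x a ⊎ only x b)
only-++ {suc n} zero a b = cong ((a ++ b) ∷_) (Eq.sym (⊎-identityˡ ∅))
only-++ {suc n} (suc x) a b = cong ([] ∷_) (only-++ x a b)

only-· : ∀ {n} (x : Fin n) u a → only x (scaleI u a) ≡ (u · only x a)
only-· {suc n} zero u a = cong (scaleI u a ∷_) (Eq.sym (·-∅ u))
only-· {suc n} (suc x) u a = cong ([] ∷_) (only-· x u a)

only-cong : ∀ {n} (x : Fin n) {a b} → a ≈I b → only x a ≈C only x b
only-cong {suc n} zero p = p VP.∷ ≈C-refl ∅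
only-cong {suc n} (suc x) p = ≈I-refl [] VP.∷ only-cong x p

-- Contexts around the k-th variable, for weakening and substitution under k binders

extⁿ : ∀ k {n m} → (Fin n → Fin m) → Fin (k N.+ n) → Fin (k N.+ m)
extⁿ zero ρ = ρ
extⁿ (suc k) ρ = ext (extⁿ k ρ)

extsⁿ : ∀ k {n m} → (Fin n → Val m) → Fin (k N.+ n) → Val (k N.+ m)
extsⁿ zero σ = σ
extsⁿ (suc k) σ = exts (extsⁿ k σ)

insertNil : ∀ k {n} → Ctx (k N.+ n) → Ctx (k N.+ suc n)
insertNil zero Θ = [] ∷ Θ
insertNil (suc k) (x ∷ Θ) = x ∷ insertNil k Θ

insertNil-⊎ : ∀ k {n} (Γ Δ : Ctx (k N.+ n)) → insertNil k (Γ ⊎ Δ) ≡ (insertNil k Γ ⊎ insertNil k Δ)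
insertNil-⊎ zero Γ Δ = Eq.refl
insertNil-⊎ (suc k) (x ∷ Γ) (y ∷ Δ) = cong ((x ++ y) ∷_) (insertNil-⊎ k Γ Δ)

insertNil-· : ∀ k {n} u (Γ : Ctx (k N.+ n)) → insertNil k (u · Γ) ≡ (u · insertNil k Γ)
insertNil-· zero u Γ = Eq.refl
insertNil-· (suc k) u (x ∷ Γ) = cong (scaleI u x ∷_) (insertNil-· k u Γ)

insertNil-∅ : ∀ k {n} → insertNil k {n} ∅ ≡ ∅
insertNil-∅ zero = Eq.refl
insertNil-∅ (suc k) = cong ([] ∷_) (insertNil-∅ k)

insertNil-only : ∀ k {n} (j : Fin (k N.+ n)) a → insertNil k (only j a) ≡ only (extⁿ k suc j) a
insertNil-only zero j a = Eq.refl
insertNil-only (suc k) zero a = cong (a ∷_) (insertNil-∅ k)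
insertNil-only (suc k) (suc j) a = cong ([] ∷_) (insertNil-only k j a)

insertNil-cong : ∀ k {n} {Γ Δ : Ctx (k N.+ n)} → Γ ≈C Δ → insertNil k Γ ≈C insertNil k Δ
insertNil-cong zero p = ≈I-refl [] VP.∷ p
insertNil-cong (suc k) (x VP.∷ p) = x VP.∷ insertNil-cong k p

at : ∀ k {n} → Ctx (k N.+ suc n) → Inter
at zero (x ∷ Θ) = x
at (suc k) (x ∷ Θ) = at k Θ

removeAt : ∀ k {n} → Ctx (k N.+ suc n) → Ctx (k N.+ n)
removeAt zero (x ∷ Θ) = Θ
removeAt (suc k) (x ∷ Θ) = x ∷ removeAt k Θ

nils++ : ∀ k {n} → Ctx n → Ctx (k N.+ n)
nils++ zero Δ = Δ
nils++ (suc k) Δ = [] ∷ nils++ k Δ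

at-⊎ : ∀ k {n} (Γ Δ : Ctx (k N.+ suc n)) → at k (Γ ⊎ Δ) ≡ (at k Γ ++ at k Δ)
at-⊎ zero (x ∷ Γ) (y ∷ Δ) = Eq.refl
at-⊎ (suc k) (x ∷ Γ) (y ∷ Δ) = at-⊎ k Γ Δ

removeAt-⊎ : ∀ k {n} (Γ Δ : Ctx (k N.+ suc n)) → removeAt k (Γ ⊎ Δ) ≡ (removeAt k Γ ⊎ removeAt k Δ)
removeAt-⊎ zero (x ∷ Γ) (y ∷ Δ) = Eq.refl
removeAt-⊎ (suc k) (x ∷ Γ) (y ∷ Δ) = cong ((x ++ y) ∷_) (removeAt-⊎ k Γ Δ)

at-· : ∀ k {n} u (Γ : Ctx (k N.+ suc n)) → at k (u · Γ) ≡ scaleI u (at k Γ)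
at-· zero u (x ∷ Γ) = Eq.refl
at-· (suc k) u (x ∷ Γ) = at-· k u Γ

removeAt-· : ∀ k {n} u (Γ : Ctx (k N.+ suc n)) → removeAt k (u · Γ) ≡ (u · removeAt k Γ)
removeAt-· zero u (x ∷ Γ) = Eq.refl
removeAt-· (suc k) u (x ∷ Γ) = cong (scaleI u x ∷_) (removeAt-· k u Γ)

at-∅ : ∀ k {n} → at k {n} ∅ ≡ []
at-∅ zero = Eq.refl
at-∅ (suc k) = at-∅ k

removeAt-∅ : ∀ k {n} → removeAt k {n} ∅ ≡ ∅
removeAt-∅ zero = Eq.refl
removeAt-∅ (suc k) = cong ([] ∷_) (removeAt-∅ k)

at-cong : ∀ k {n} {Γ Δ : Ctx (k N.+ suc n)} → Γ ≈C Δ → at k Γ ≈I at k Δ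
at-cong zero (x VP.∷ p) = x
at-cong (suc k) (x VP.∷ p) = at-cong k p

removeAt-cong : ∀ k {n} {Γ Δ : Ctx (k N.+ suc n)} → Γ ≈C Δ → removeAt k Γ ≈C removeAt k Δ
removeAt-cong zero (x VP.∷ p) = p
removeAt-cong (suc k) (x VP.∷ p) = x VP.∷ removeAt-cong k p

nils++-⊎ : ∀ k {n} (Γ Δ : Ctx n) → nils++ k (Γ ⊎ Δ) ≡ (nils++ k Γ ⊎ nils++ k Δ)
nils++-⊎ zero Γ Δ = Eq.refl
nils++-⊎ (suc k) Γ Δ = cong ([] ∷_) (nils++-⊎ k Γ Δ)

nils++-· : ∀ k {n} u (Γ : Ctx n) → nils++ k (u · Γ) ≡ (u · nils++ k Γ)
nils++-· zero u Γ = Eq.refl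
nils++-· (suc k) u Γ = cong ([] ∷_) (nils++-· k u Γ)

nils++-∅ : ∀ k {n} → nils++ k {n} ∅ ≡ ∅
nils++-∅ zero = Eq.refl
nils++-∅ (suc k) = cong ([] ∷_) (nils++-∅ k)

nils++-cong : ∀ k {n} {Γ Δ : Ctx n} → Γ ≈C Δ → nils++ k Γ ≈C nils++ k Δ
nils++-cong zero p = p
nils++-cong (suc k) p = ≈I-refl [] VP.∷ nils++-cong k p

mutual
  sizeA : ∀ {n} {Γ : Ctx n} {w V A} → Γ ⊢A w ∣ V ∶ A → ℕ
  sizeA (⊢λ d) = suc (size d)
  sizeA (convA d _ _) = sizeA d

  sizeI : ∀ {n} {Γ : Ctx n} {w V A} → Γ ⊢I w ∣ V ∶ A → ℕ
  sizeI (⊢var _) = 0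
  sizeI (⊢! b) = sizeBang b
  sizeI (convI d _ _) = sizeI d

  sizeBang : ∀ {n} {Γ : Ctx n} {w V A} → Bang Γ w V A → ℕ
  sizeBang bnil = 0
  sizeBang (bcons q _ d b) = sizeA d N.+ sizeBang b

  size : ∀ {n} {Γ : Ctx n} {w M a} → Γ ⊢ w ∣ M ∶ a → ℕ
  size ⊢zero = 0
  size (⊢app d e) = sizeI d N.+ sizeI e
  size (⊢⊕ d e) = suc (size d N.+ size e)
  size (⊢let d b) = suc (size d N.+ sizeBr b)
  size (⊢val d) = sizeI d
  size (conv d _ _) = size d

  sizeBr : ∀ {n} {Γ : Ctx n} {w M a c} → Branches Γ w M a c → ℕ
  sizeBr brnil = 0
  sizeBr (brcons d b) = size d N.+ sizeBr b

castWeight : ∀ {n} {Γ : Ctx n} {w w' M a} → w ≡ w' → Γ ⊢ w ∣ M ∶ a → Γ ⊢ w' ∣ M ∶ a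
castWeight Eq.refl d = d

size-castWeight : ∀ {n} {Γ : Ctx n} {w w' M a} (e : w ≡ w') (d : Γ ⊢ w ∣ M ∶ a) →
  size (castWeight e d) ≡ size d
size-castWeight Eq.refl d = Eq.refl

castWeightI : ∀ {n} {Γ : Ctx n} {w w' M a} → w ≡ w' → Γ ⊢I w ∣ M ∶ a → Γ ⊢I w' ∣ M ∶ a
castWeightI Eq.refl d = d

size-castWeightI : ∀ {n} {Γ : Ctx n} {w w' M a} (e : w ≡ w') (d : Γ ⊢I w ∣ M ∶ a) →
  sizeI (castWeightI e d) ≡ sizeI d
size-castWeightI Eq.refl d = Eq.refl

castWeightA : ∀ {n} {Γ : Ctx n} {w w' M a} → w ≡ w' → Γ ⊢A w ∣ M ∶ a → Γ ⊢A w' ∣ M ∶ a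
castWeightA Eq.refl d = d

size-castWeightA : ∀ {n} {Γ : Ctx n} {w w' M a} (e : w ≡ w') (d : Γ ⊢A w ∣ M ∶ a) →
  sizeA (castWeightA e d) ≡ sizeA d
size-castWeightA Eq.refl d = Eq.refl

-- Rule (!) without the side condition 0 < q ≤ 1, which dividing out a
-- common factor (looseBang-unscale) would not preserve.
data LooseBang {n} : Ctx n → ℚ → Val n → Inter → Set where
  lnil : ∀ {V} → LooseBang ∅ 0ℚ V []
  lcons : ∀ {Γ Δ w v V A 𝓜} (q : ℚ) → Γ ⊢A w ∣ V ∶ A → LooseBang Δ v V 𝓜 →
          LooseBang ((q · Γ) ⊎ Δ) (q Q.* w Q.+ v) V ((q , A) ∷ 𝓜)

sizeLoose : ∀ {n} {Γ : Ctx n} {w V A} → LooseBang Γ w V A → ℕ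
sizeLoose lnil = 0
sizeLoose (lcons q d b) = sizeA d N.+ sizeLoose b

castWeightLoose : ∀ {n} {Γ : Ctx n} {w w' M a} → w ≡ w' → LooseBang Γ w M a → LooseBang Γ w' M a
castWeightLoose Eq.refl d = d

size-castWeightLoose : ∀ {n} {Γ : Ctx n} {w w' M a} (e : w ≡ w') (d : LooseBang Γ w M a) →
  sizeLoose (castWeightLoose e d) ≡ sizeLoose d
size-castWeightLoose Eq.refl d = Eq.refl

-- A derivation of Δ ⊢I v ∣ V ∶ 𝓜 whose conversions are collected into a
-- single context equivalence.
data NormalI {n} (Δ : Ctx n) (v : ℚ) (V : Val n) (𝓜 : Inter) : Set where
  nvar : ∀ x → V ≡ var x → only x 𝓜 ≈C Δ → v ≡ 0ℚ → NormalI Δ v V 𝓜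
  nbang : ∀ {Δ'} → LooseBang Δ' v V 𝓜 → Δ' ≈C Δ → NormalI Δ v V 𝓜

sizeNormal : ∀ {n} {Γ : Ctx n} {w V A} → NormalI Γ w V A → ℕ
sizeNormal (nvar _ _ _ _) = 0
sizeNormal (nbang b _) = sizeLoose b

normalI-resp-≈C : ∀ {n} {Δ Δ' : Ctx n} {v V 𝓜} → NormalI Δ v V 𝓜 → Δ ≈C Δ' → NormalI Δ' v V 𝓜
normalI-resp-≈C (nvar x e c e') c' = nvar x e (≈C-trans c c') e'
normalI-resp-≈C (nbang b c) c' = nbang b (≈C-trans c c')

size-normalI-resp-≈C : ∀ {n} {Δ Δ' : Ctx n} {v V 𝓜} (e : NormalI Δ v V 𝓜) (c : Δ ≈C Δ') →
  sizeNormal (normalI-resp-≈C e c) ≡ sizeNormal e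
size-normalI-resp-≈C (nvar x e c e') c' = Eq.refl
size-normalI-resp-≈C (nbang b c) c' = Eq.refl

record LooseBang≈ {n} (Δ : Ctx n) (v : ℚ) (V : Val n) (𝓝 : Inter) (s : ℕ) : Set where
  constructor mkLooseBang≈
  field
    {Δ'} : Ctx n
    b : LooseBang Δ' v V 𝓝
    c : Δ ≈C Δ'
    s≡ : sizeLoose b ≡ s

mutual
  looseBang-perm : ∀ {n} {Δ : Ctx n} {v V 𝓜 𝓝} → (b : LooseBang Δ v V 𝓜) → Permutation _≈[A]_ 𝓜 𝓝 →
    LooseBang≈ Δ v V 𝓝 (sizeLoose b)
  looseBang-perm b (refl x) = looseBang-pointwise b x
  looseBang-perm (lcons q d b) (prep (Eq.refl , a) p) with looseBang-perm b p
  ... | mkLooseBang≈ b' c s≡ =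
    mkLooseBang≈ (lcons q (convA d (≈C-refl _) a) b') (⊎-cong (≈C-refl _) c) (cong (sizeA d N.+_) s≡)
  looseBang-perm (lcons {Γ = Γ₁} {w = w₁} q d (lcons {Γ = Γ₂} {Δ = Δ₀} {w = w₂} {v = v₀} q' d' b))
                 (swap (Eq.refl , a) (Eq.refl , a') p) with looseBang-perm b p
  ... | mkLooseBang≈ {Δ'} b' c s≡ = mkLooseBang≈ (castWeightLoose weight≡ swapped) (⊎-swap-cong (q · Γ₁) (q' · Γ₂) Δ₀ Δ' c)
          (Eq.trans (size-castWeightLoose weight≡ swapped)
            (Eq.trans (cong (λ z → sizeA d' N.+ (sizeA d N.+ z)) s≡) (ℕ+.x∙yz≈y∙xz (sizeA d') (sizeA d) (sizeLoose b))))
    where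
    swapped = lcons q' (convA d' (≈C-refl _) a') (lcons q (convA d (≈C-refl _) a) b')
    weight≡ : q' Q.* w₂ Q.+ (q Q.* w₁ Q.+ v₀) ≡ q Q.* w₁ Q.+ (q' Q.* w₂ Q.+ v₀)
    weight≡ = solve 5 (λ q q' w₁ w₂ v → q' :* w₂ :+ (q :* w₁ :+ v) := q :* w₁ :+ (q' :* w₂ :+ v)) Eq.refl q q' w₁ w₂ v₀
  looseBang-perm b (trans p q) with looseBang-perm b p
  ... | mkLooseBang≈ b' c s≡ with looseBang-perm b' q
  ... | mkLooseBang≈ b'' c' s≡' = mkLooseBang≈ b'' (≈C-trans c c') (Eq.trans s≡' s≡)

  looseBang-pointwise : ∀ {n} {Δ : Ctx n} {v V 𝓜 𝓝} → (b : LooseBang Δ v V 𝓜) → Pointwise _≈[A]_ 𝓜 𝓝 →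
    LooseBang≈ Δ v V 𝓝 (sizeLoose b)
  looseBang-pointwise lnil [] = mkLooseBang≈ lnil (≈C-refl _) Eq.refl
  looseBang-pointwise (lcons q d b) ((Eq.refl , a) ∷ p) with looseBang-pointwise b p
  ... | mkLooseBang≈ b' c s≡ =
    mkLooseBang≈ (lcons q (convA d (≈C-refl _) a) b') (⊎-cong (≈C-refl _) c) (cong (sizeA d N.+_) s≡)

normalI-resp-≈I : ∀ {n} {Δ : Ctx n} {v V 𝓜 𝓝} → (e : NormalI Δ v V 𝓜) → 𝓜 ≈I 𝓝 →
  Σ (NormalI Δ v V 𝓝) λ e' → sizeNormal e' ≡ sizeNormal e
normalI-resp-≈I (nvar x eq c e0) p = nvar x eq (≈C-trans (only-cong x (≈I-sym p)) c) e0 , Eq.refl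
normalI-resp-≈I (nbang b c) (permI p) with looseBang-perm b p
... | mkLooseBang≈ b' c' s≡ = nbang b' (≈C-trans (≈C-sym c') c) , s≡

record NormalISplit {n} (Δ : Ctx n) (v : ℚ) (V : Val n) (𝓜₁ 𝓜₂ : Inter) (s : ℕ) : Set where
  constructor mkNormalISplit
  field
    {Δ₁ Δ₂} : Ctx n
    {v₁ v₂} : ℚ
    e₁ : NormalI Δ₁ v₁ V 𝓜₁
    e₂ : NormalI Δ₂ v₂ V 𝓜₂
    ctx : (Δ₁ ⊎ Δ₂) ≈C Δ
    wt : v ≡ v₁ Q.+ v₂
    sz≡ : sizeNormal e₁ N.+ sizeNormal e₂ ≡ s

record LooseBangSplit {n} (Δ : Ctx n) (v : ℚ) (V : Val n) (𝓜₁ 𝓜₂ : Inter) (s : ℕ) : Set where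
  constructor mkLooseBangSplit
  field
    {Δ₁ Δ₂} : Ctx n
    {v₁ v₂} : ℚ
    b₁ : LooseBang Δ₁ v₁ V 𝓜₁
    b₂ : LooseBang Δ₂ v₂ V 𝓜₂
    ctx : (Δ₁ ⊎ Δ₂) ≡ Δ
    wt : v ≡ v₁ Q.+ v₂
    sz≡ : sizeLoose b₁ N.+ sizeLoose b₂ ≡ s

looseBang-split : ∀ {n} {Δ : Ctx n} {v V} 𝓜₁ {𝓜₂} → (b : LooseBang Δ v V (𝓜₁ ++ 𝓜₂)) →
  LooseBangSplit Δ v V 𝓜₁ 𝓜₂ (sizeLoose b)
looseBang-split [] b = mkLooseBangSplit lnil b (⊎-identityˡ _) (Eq.sym (QP.+-identityˡ _)) Eq.refl
looseBang-split (x ∷ 𝓜₁) (lcons {Γ = Γ} {w = w} q d b) with looseBang-split 𝓜₁ b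
... | mkLooseBangSplit {Δ₁} {Δ₂} {v₁} {v₂} b₁ b₂ ctx wt s≡ =
  mkLooseBangSplit (lcons q d b₁) b₂ (Eq.trans (⊎-assoc (q · Γ) Δ₁ Δ₂) (cong ((q · Γ) ⊎_) ctx))
    (Eq.trans (cong (q Q.* w Q.+_) wt) (Eq.sym (QP.+-assoc (q Q.* w) v₁ v₂)))
    (Eq.trans (NP.+-assoc (sizeA d) (sizeLoose b₁) (sizeLoose b₂)) (cong (sizeA d N.+_) s≡))

normalI-split : ∀ {n} {Δ : Ctx n} {v V} 𝓜₁ {𝓜₂} → (e : NormalI Δ v V (𝓜₁ ++ 𝓜₂)) →
  NormalISplit Δ v V 𝓜₁ 𝓜₂ (sizeNormal e)
normalI-split 𝓜₁ {𝓜₂} (nvar x eq c e0) =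
  mkNormalISplit (nvar x eq (≈C-refl _) Eq.refl) (nvar x eq (≈C-refl _) Eq.refl)
    (≈C-trans (≈C-reflexive (Eq.sym (only-++ x 𝓜₁ 𝓜₂))) c) (Eq.trans e0 (Eq.sym (QP.+-identityˡ 0ℚ))) Eq.refl
normalI-split 𝓜₁ (nbang b c) with looseBang-split 𝓜₁ b
... | mkLooseBangSplit b₁ b₂ ctx wt s≡ =
  mkNormalISplit (nbang b₁ (≈C-refl _)) (nbang b₂ (≈C-refl _)) (≈C-trans (≈C-reflexive ctx) c) wt s≡

record NormalIUnscaled {n} (Δ : Ctx n) (v : ℚ) (V : Val n) (u : ℚ) (𝓜 : Inter) (s : ℕ) : Set where
  constructor mkNormalIUnscaled
  field
    {Δ'} : Ctx n
    {v'} : ℚ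
    e' : NormalI Δ' v' V 𝓜
    ctx : (u · Δ') ≈C Δ
    wt : v ≡ u Q.* v'
    sz≡ : sizeNormal e' ≡ s

record LooseBangUnscaled {n} (Δ : Ctx n) (v : ℚ) (V : Val n) (u : ℚ) (𝓜 : Inter) (s : ℕ) : Set where
  constructor mkLooseBangUnscaled
  field
    {Δ'} : Ctx n
    {v'} : ℚ
    b' : LooseBang Δ' v' V 𝓜
    ctx : (u · Δ') ≡ Δ
    wt : v ≡ u Q.* v'
    sz≡ : sizeLoose b' ≡ s

looseBang-unscale : ∀ {n} {Δ : Ctx n} {v V 𝓝} u 𝓜 → (b : LooseBang Δ v V 𝓝) → 𝓝 ≡ scaleI u 𝓜 →
  LooseBangUnscaled Δ v V u 𝓜 (sizeLoose b)
looseBang-unscale u [] lnil eq = mkLooseBangUnscaled lnil (·-∅ u) (Eq.sym (QP.*-zeroʳ u)) Eq.refl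
looseBang-unscale u ((r , B) ∷ 𝓜) (lcons {Γ = Γ} {w = w} .(u Q.* r) d b) Eq.refl with looseBang-unscale u 𝓜 b Eq.refl
... | mkLooseBangUnscaled {Δ'} {v'} b' ctx wt s≡ =
  mkLooseBangUnscaled (lcons r d b') (Eq.trans (·-distrib-⊎ u (r · Γ) Δ') (cong₂ _⊎_ (·-· u r Γ) ctx))
    (Eq.trans (cong ((u Q.* r) Q.* w Q.+_) wt)
      (solve 4 (λ u r w v → (u :* r) :* w :+ u :* v := u :* (r :* w :+ v)) Eq.refl u r w v'))
    (cong (sizeA d N.+_) s≡)

normalI-unscale : ∀ {n} {Δ : Ctx n} {v V 𝓝} u 𝓜 → (e : NormalI Δ v V 𝓝) → 𝓝 ≡ scaleI u 𝓜 →
  NormalIUnscaled Δ v V u 𝓜 (sizeNormal e)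
normalI-unscale u 𝓜 (nvar x eq c e0) Eq.refl =
  mkNormalIUnscaled (nvar x eq (≈C-refl _) Eq.refl) (≈C-trans (≈C-reflexive (Eq.sym (only-· x u 𝓜))) c)
    (Eq.trans e0 (Eq.sym (QP.*-zeroʳ u))) Eq.refl
normalI-unscale u 𝓜 (nbang b c) eq with looseBang-unscale u 𝓜 b eq
... | mkLooseBangUnscaled b' ctx wt s≡ = mkNormalIUnscaled (nbang b' (≈C-refl _)) (≈C-trans (≈C-reflexive ctx) c) wt s≡

normalI-[] : ∀ {n} {Δ : Ctx n} {v V} → NormalI Δ v V [] → (∅ ≈C Δ) × (v ≡ 0ℚ)
normalI-[] (nvar x eq c e0) = ≈C-trans (≈C-reflexive (Eq.sym (only-[] x))) c , e0
normalI-[] (nbang lnil c) = c , Eq.refl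

fromLooseBang : ∀ {n} {Δ : Ctx n} {v V 𝓜} → (b : LooseBang Δ v V 𝓜) → WFI 𝓜 → Σ (Bang Δ v V 𝓜) λ b' →
  sizeBang b' ≡ sizeLoose b
fromLooseBang lnil [] = bnil , Eq.refl
fromLooseBang (lcons q d b) ((iu , _) ∷ wf) with fromLooseBang b wf
... | b' , s≡ = bcons q iu d b' , cong (sizeA d N.+_) s≡

fromNormalI : ∀ {n} {Δ : Ctx n} {v V 𝓜} → (e : NormalI Δ v V 𝓜) → WFI 𝓜 → Σ (Δ ⊢I v ∣ V ∶ 𝓜) λ d →
  sizeI d ≡ sizeNormal e
fromNormalI (nvar x Eq.refl c Eq.refl) wf = convI (⊢var wf) c (≈I-refl _) , Eq.refl
fromNormalI (nbang b c) wf with fromLooseBang b wf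
... | b' , s≡ = convI (⊢! b') c (≈I-refl _) , s≡

toLooseBang : ∀ {n} {Δ : Ctx n} {v V 𝓜} → (b : Bang Δ v V 𝓜) → Σ (LooseBang Δ v V 𝓜) λ b' →
  sizeLoose b' ≡ sizeBang b
toLooseBang bnil = lnil , Eq.refl
toLooseBang (bcons q _ d b) with toLooseBang b
... | b' , s≡ = lcons q d b' , cong (sizeA d N.+_) s≡

toNormalI : ∀ {n} {Δ : Ctx n} {v V 𝓜} → (d : Δ ⊢I v ∣ V ∶ 𝓜) → Σ (NormalI Δ v V 𝓜) λ e →
  sizeNormal e ≡ sizeI d
toNormalI (⊢var {x} wf) = nvar x Eq.refl (≈C-refl _) Eq.refl , Eq.refl
toNormalI (⊢! b) with toLooseBang b
... | b' , s≡ = nbang b' (≈C-refl _) , s≡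
toNormalI (convI d c p) with toNormalI d
... | e , s≡ with normalI-resp-≈I (normalI-resp-≈C e c) p
... | e' , s≡' = e' , Eq.trans s≡' (Eq.trans (size-normalI-resp-≈C e c) s≡)

-- Weakening and substitution

record WeakenedBang k {n} (Δ : Ctx (k N.+ n)) (v : ℚ) (V : Val (k N.+ n)) (𝓜 : Inter) (s : ℕ) : Set where
  constructor mkWeakenedBang
  field
    {Δ'} : Ctx (k N.+ suc n)
    b : Bang Δ' v (renV (extⁿ k suc) V) 𝓜
    c : Δ' ≈C insertNil k Δ
    s≡ : sizeBang b ≡ s

record WeakenedBranches k {n} (Δ : Ctx (k N.+ n)) (u : ℚ) (M : Tm (suc (k N.+ n))) (a c : TDist) (s : ℕ) : Set where
  constructor mkWeakenedBranches
  field
    {Δ'} : Ctx (k N.+ suc n)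
    b : Branches Δ' u (renT (ext (extⁿ k suc)) M) a c
    ctx : Δ' ≈C insertNil k Δ
    s≡ : sizeBr b ≡ s

mutual
  weaken : ∀ k {n} {Θ : Ctx (k N.+ n)} {w M b} (d : Θ ⊢ w ∣ M ∶ b) →
    Σ (insertNil k Θ ⊢ w ∣ renT (extⁿ k suc) M ∶ b) λ d' → size d' ≡ size d
  weaken k ⊢zero = conv ⊢zero (≈C-reflexive (Eq.sym (insertNil-∅ k))) (≈D-refl []) , Eq.refl
  weaken k (⊢app {Γ} {Δ} d e) with weakenI k d | weakenI k e
  ... | d' , s₁ | e' , s₂ =
    conv (⊢app d' e') (≈C-reflexive (Eq.sym (insertNil-⊎ k Γ Δ))) (≈D-refl _) , cong₂ N._+_ s₁ s₂
  weaken k (⊢⊕ {Γ} {Δ} d e) with weaken k d | weaken k e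
  ... | d' , s₁ | e' , s₂ = conv (⊢⊕ d' e')
          (≈C-reflexive (Eq.sym (Eq.trans (insertNil-⊎ k (½ · Γ) (½ · Δ))
                                          (cong₂ _⊎_ (insertNil-· k ½ Γ) (insertNil-· k ½ Δ)))))
          (≈D-refl _)
        , cong suc (cong₂ N._+_ s₁ s₂)
  weaken k (⊢let {Γ} {Θ} d br) with weaken k d | weakenBr k br
  ... | d' , s₁ | mkWeakenedBranches br' c s₂ =
    conv (⊢let d' br') (≈C-trans (⊎-cong (≈C-refl _) c) (≈C-reflexive (Eq.sym (insertNil-⊎ k Γ Θ)))) (≈D-refl _)
        , cong suc (cong₂ N._+_ s₁ s₂)
  weaken k (⊢val d) with weakenI k d
  ... | d' , s = ⊢val d' , s
  weaken k (conv d c a) with weaken k d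
  ... | d' , s = conv d' (insertNil-cong k c) a , s

  weakenI : ∀ k {n} {Θ : Ctx (k N.+ n)} {w V 𝓜} (d : Θ ⊢I w ∣ V ∶ 𝓜) →
    Σ (insertNil k Θ ⊢I w ∣ renV (extⁿ k suc) V ∶ 𝓜) λ d' → sizeI d' ≡ sizeI d
  weakenI k (⊢var {x} {𝓜} wf) = convI (⊢var wf) (≈C-reflexive (Eq.sym (insertNil-only k x 𝓜))) (≈I-refl _) , Eq.refl
  weakenI k (⊢! b) with weakenBang k b
  ... | mkWeakenedBang b' c s = convI (⊢! b') c (≈I-refl _) , s
  weakenI k (convI d c p) with weakenI k d
  ... | d' , s = convI d' (insertNil-cong k c) p , s

  weakenA : ∀ k {n} {Θ : Ctx (k N.+ n)} {w V A} (d : Θ ⊢A w ∣ V ∶ A) →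
    Σ (insertNil k Θ ⊢A w ∣ renV (extⁿ k suc) V ∶ A) λ d' → sizeA d' ≡ sizeA d
  weakenA k (⊢λ d) with weaken (suc k) d
  ... | d' , s = ⊢λ d' , cong suc s
  weakenA k (convA d c p) with weakenA k d
  ... | d' , s = convA d' (insertNil-cong k c) p , s

  weakenBang : ∀ k {n} {Θ : Ctx (k N.+ n)} {w V 𝓜} (b : Bang Θ w V 𝓜) → WeakenedBang k Θ w V 𝓜 (sizeBang b)
  weakenBang k bnil = mkWeakenedBang bnil (≈C-reflexive (Eq.sym (insertNil-∅ k))) Eq.refl
  weakenBang k (bcons {Γ} {Δ} q iu d b) with weakenA k d | weakenBang k b
  ... | d' , s₁ | mkWeakenedBang b' c s₂ = mkWeakenedBang (bcons q iu d' b')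
        (≈C-trans (⊎-cong (≈C-refl _) c)
                  (≈C-reflexive (Eq.sym (Eq.trans (insertNil-⊎ k (q · Γ) Δ) (cong (_⊎ insertNil k Δ) (insertNil-· k q Γ))))))
        (cong₂ N._+_ s₁ s₂)

  weakenBr : ∀ k {n} {Θ : Ctx (k N.+ n)} {u M a c} (b : Branches Θ u M a c) →
    WeakenedBranches k Θ u M a c (sizeBr b)
  weakenBr k brnil = mkWeakenedBranches brnil (≈C-reflexive (Eq.sym (insertNil-∅ k))) Eq.refl
  weakenBr k (brcons {Δ} {Θ} {p = p} d b) with weaken (suc k) d | weakenBr k b
  ... | d' , s₁ | mkWeakenedBranches b' c s₂ = mkWeakenedBranches (brcons d' b')
        (≈C-trans (⊎-cong (≈C-refl _) c)
                  (≈C-reflexive (Eq.sym (Eq.trans (insertNil-⊎ k (p · Δ) Θ) (cong (_⊎ insertNil k Θ) (insertNil-· k p Δ))))))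
        (cong₂ N._+_ s₁ s₂)

size-+-bound : ∀ x y s₁ s₂ {a b s} → a N.≤ x N.+ s₁ → b N.≤ y N.+ s₂ → s₁ N.+ s₂ ≡ s →
  a N.+ b N.≤ (x N.+ y) N.+ s
size-+-bound x y s₁ s₂ p q Eq.refl = NP.≤-trans (NP.+-mono-≤ p q)
  (NP.≤-reflexive (ℕ+.interchange x s₁ y s₂))

subst-ctx-⊎ : ∀ k {n} (Γ Δ₀ : Ctx (k N.+ suc n)) (Δ₁ Δ₂ Δ : Ctx n) → (Δ₁ ⊎ Δ₂) ≈C Δ →
  ((removeAt k Γ ⊎ nils++ k Δ₁) ⊎ (removeAt k Δ₀ ⊎ nils++ k Δ₂)) ≈C (removeAt k (Γ ⊎ Δ₀) ⊎ nils++ k Δ)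
subst-ctx-⊎ k Γ Δ₀ Δ₁ Δ₂ Δ c =
  ≈C-trans (⊎-interchange (removeAt k Γ) (nils++ k Δ₁) (removeAt k Δ₀) (nils++ k Δ₂))
    (⊎-cong (≈C-reflexive (Eq.sym (removeAt-⊎ k Γ Δ₀)))
            (≈C-trans (≈C-reflexive (Eq.sym (nils++-⊎ k Δ₁ Δ₂))) (nils++-cong k c)))

subst-ctx-· : ∀ k {n} u (Γ : Ctx (k N.+ suc n)) (Δ₁ : Ctx n) →
  (u · (removeAt k Γ ⊎ nils++ k Δ₁)) ≡ (removeAt k (u · Γ) ⊎ nils++ k (u · Δ₁))
subst-ctx-· k u Γ Δ₁ =
  Eq.trans (·-distrib-⊎ u (removeAt k Γ) (nils++ k Δ₁)) (cong₂ _⊎_ (Eq.sym (removeAt-· k u Γ)) (Eq.sym (nils++-· k u Δ₁)))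

subst-ctx-·⊎ : ∀ k {n} u (Γ Δ₀ : Ctx (k N.+ suc n)) (Δ₁' Δ₂ Δ : Ctx n) (Y : Ctx (k N.+ n)) →
  Y ≈C (removeAt k Δ₀ ⊎ nils++ k Δ₂) →
  ((u · Δ₁') ⊎ Δ₂) ≈C Δ → ((u · (removeAt k Γ ⊎ nils++ k Δ₁')) ⊎ Y) ≈C (removeAt k ((u · Γ) ⊎ Δ₀) ⊎ nils++ k Δ)
subst-ctx-·⊎ k u Γ Δ₀ Δ₁' Δ₂ Δ Y cY c =
  ≈C-trans (⊎-cong (≈C-reflexive (subst-ctx-· k u Γ Δ₁')) cY) (subst-ctx-⊎ k (u · Γ) Δ₀ (u · Δ₁') Δ₂ Δ c)

subst-ctx-∅ : ∀ k {n} {Δ : Ctx n} → ∅ ≈C Δ → ∅ ≈C (removeAt k {n} ∅ ⊎ nils++ k Δ)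
subst-ctx-∅ k {Δ = Δ} c = ≈C-trans (≈C-reflexive (Eq.sym (Eq.trans (cong₂ _⊎_ (removeAt-∅ k) (nils++-∅ k)) (⊎-identityˡ ∅))))
   (⊎-cong (≈C-refl _) (nils++-cong k c))

subst-weight-·⊎ : ∀ u w v₁ u₀ v₂ {v} → v ≡ u Q.* v₁ Q.+ v₂ →
  u Q.* (w Q.+ v₁) Q.+ (u₀ Q.+ v₂) ≡ (u Q.* w Q.+ u₀) Q.+ v
subst-weight-·⊎ u w v₁ u₀ v₂ Eq.refl =
  solve 5 (λ u w v₁ u₀ v₂ → u :* (w :+ v₁) :+ (u₀ :+ v₂) := (u :* w :+ u₀) :+ (u :* v₁ :+ v₂)) Eq.refl u w v₁ u₀ v₂

normalI-at-∅ : ∀ k {n} {Δ : Ctx n} {v V} → NormalI Δ v V (at k {n} ∅) → (∅ ≈C Δ) × (v ≡ 0ℚ)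
normalI-at-∅ k e = normalI-[] (proj₁ (normalI-resp-≈I e (≈I-reflexive (at-∅ k))))

normalI-split-at : ∀ k {n} (Γ Δ₀ : Ctx (k N.+ suc n)) {Δ : Ctx n} {v V} (e : NormalI Δ v V (at k (Γ ⊎ Δ₀))) →
  NormalISplit Δ v V (at k Γ) (at k Δ₀) (sizeNormal e)
normalI-split-at k Γ Δ₀ e with normalI-resp-≈I e (≈I-reflexive (at-⊎ k Γ Δ₀))
... | e₀ , s₀ with normalI-split (at k Γ) e₀
... | mkNormalISplit e₁ e₂ ctx wt s≡ = mkNormalISplit e₁ e₂ ctx wt (Eq.trans s≡ s₀)

record ScaledSplit {n} (q : ℚ) (Δ : Ctx n) (v : ℚ) (V : Val n) (𝓜₁ 𝓜₂ : Inter) (s : ℕ) : Set where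
  constructor mkScaledSplit
  field
    {Δ₁ Δ₂} : Ctx n
    {v₁ v₂} : ℚ
    e₁ : NormalI Δ₁ v₁ V 𝓜₁
    e₂ : NormalI Δ₂ v₂ V 𝓜₂
    ctx : ((q · Δ₁) ⊎ Δ₂) ≈C Δ
    wt : v ≡ q Q.* v₁ Q.+ v₂
    sz≡ : sizeNormal e₁ N.+ sizeNormal e₂ ≡ s

normalI-split-at-· : ∀ k {n} q (Γ Δ₀ : Ctx (k N.+ suc n)) {Δ : Ctx n} {v V} (e : NormalI Δ v V (at k ((q · Γ) ⊎ Δ₀))) →
  ScaledSplit q Δ v V (at k Γ) (at k Δ₀) (sizeNormal e)
normalI-split-at-· k q Γ Δ₀ e with normalI-split-at k (q · Γ) Δ₀ e
... | mkNormalISplit e₁ e₂ ctx wt s≡ with normalI-unscale q (at k Γ) e₁ (at-· k q Γ)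
... | mkNormalIUnscaled e₁' c₁ wt₁ s₁' =
  mkScaledSplit e₁' e₂ (≈C-trans (⊎-cong c₁ (≈C-refl _)) ctx) (Eq.trans wt (cong (Q._+ _) wt₁))
    (Eq.trans (cong (N._+ sizeNormal e₂) s₁') s≡)

record SubstitutedBang k {n} (Θ : Ctx (k N.+ suc n)) (w : ℚ) (V₁ : Val (k N.+ suc n)) (𝓜 : Inter)
            (Δ : Ctx n) (v : ℚ) (V : Val n) (s : ℕ) : Set where
  constructor mkSubstitutedBang
  field
    {Γ'} : Ctx (k N.+ n)
    {w'} : ℚ
    b : Bang Γ' w' (subV (extsⁿ k (single V)) V₁) 𝓜
    ctx : Γ' ≈C (removeAt k Θ ⊎ nils++ k Δ)
    wt : w' ≡ w Q.+ v
    sz≤ : sizeBang b N.≤ s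

record SubstitutedBranches k {n} (Θ : Ctx (k N.+ suc n)) (u : ℚ) (M : Tm (suc (k N.+ suc n))) (a c : TDist)
            (Δ : Ctx n) (v : ℚ) (V : Val n) (s : ℕ) : Set where
  constructor mkSubstitutedBranches
  field
    {Θ'} : Ctx (k N.+ n)
    {u'} : ℚ
    b : Branches Θ' u' (subT (exts (extsⁿ k (single V))) M) a c
    ctx : Θ' ≈C (removeAt k Θ ⊎ nils++ k Δ)
    wt : u' ≡ u Q.+ v
    sz≤ : sizeBr b N.≤ s

substVar : ∀ k {n} (x : Fin (k N.+ suc n)) 𝓜 → WFI 𝓜 →
  {Δ : Ctx n} {v : ℚ} {V : Val n} (e : NormalI Δ v V (at k (only x 𝓜))) →
  Σ ((removeAt k (only x 𝓜) ⊎ nils++ k Δ) ⊢I (0ℚ Q.+ v) ∣ extsⁿ k (single V) x ∶ 𝓜) λ d → sizeI d N.≤ sizeNormal e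
substVar zero zero 𝓜 wf {Δ} {v} e with fromNormalI e wf
... | d , s≡ = castWeightI (Eq.sym (QP.+-identityˡ v)) typing
             , NP.≤-reflexive (Eq.trans (size-castWeightI (Eq.sym (QP.+-identityˡ v)) typing) s≡)
  where typing = convI d (≈C-reflexive (Eq.sym (⊎-identityˡ Δ))) (≈I-refl _)
substVar zero (suc j) 𝓜 wf {Δ} {v} e with normalI-[] e
... | c , Eq.refl = castWeightI (Eq.sym (QP.+-identityˡ 0ℚ))
      (convI (⊢var wf) (≈C-trans (≈C-reflexive (Eq.sym (⊎-identityʳ (only j 𝓜)))) (⊎-cong (≈C-refl _) c)) (≈I-refl _)) , z≤n
substVar (suc k) zero 𝓜 wf {Δ} {v} e with normalI-at-∅ k e
... | c , Eq.refl = castWeightI (Eq.sym (QP.+-identityˡ 0ℚ))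
      (convI (⊢var wf) (≈I-reflexive (Eq.sym (++-identityʳ 𝓜)) VP.∷ subst-ctx-∅ k c) (≈I-refl _)) , z≤n
substVar (suc k) (suc j) 𝓜 wf e with substVar k j 𝓜 wf e
... | d , s with weakenI 0 d
... | d' , s' = d' , NP.≤-trans (NP.≤-reflexive s') s

mutual
  subst⊢ : ∀ k {n} {Θ : Ctx (k N.+ suc n)} {w M b} (d : Θ ⊢ w ∣ M ∶ b) {Δ : Ctx n} {v : ℚ} {V : Val n}
        (e : NormalI Δ v V (at k Θ)) →
        Σ ((removeAt k Θ ⊎ nils++ k Δ) ⊢ (w Q.+ v) ∣ subT (extsⁿ k (single V)) M ∶ b) λ d' → size d' N.≤ size d N.+ sizeNormal e
  subst⊢ k ⊢zero e with normalI-at-∅ k e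
  ... | c , Eq.refl = castWeight (Eq.sym (QP.+-identityˡ 0ℚ)) (conv ⊢zero (subst-ctx-∅ k c) (≈D-refl _)) , z≤n
  subst⊢ k (⊢app {Γ} {Δ₀} {w₁} {w₂} dV dW) {Δ} {v} e with normalI-split-at k Γ Δ₀ e
  ... | mkNormalISplit {Δ₁} {Δ₂} {v₁} {v₂} e₁ e₂ ctx wt s≡ with substI k dV e₁ | substI k dW e₂
  ... | d₁ , s₁ | d₂ , s₂ = castWeight weight≡ typing ,
        NP.≤-trans (NP.≤-reflexive (size-castWeight weight≡ typing))
                   (size-+-bound (sizeI dV) (sizeI dW) (sizeNormal e₁) (sizeNormal e₂) s₁ s₂ s≡)
    where
    typing = conv (⊢app d₁ d₂) (subst-ctx-⊎ k Γ Δ₀ Δ₁ Δ₂ Δ ctx) (≈D-refl _)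
    weight≡ : (w₁ Q.+ v₁) Q.+ (w₂ Q.+ v₂) ≡ (w₁ Q.+ w₂) Q.+ v
    weight≡ rewrite wt = solve 4 (λ a b c d → (a :+ c) :+ (b :+ d) := (a :+ b) :+ (c :+ d)) Eq.refl w₁ w₂ v₁ v₂
  subst⊢ k (⊢⊕ {Γ} {Δ₀} {w₁} {w₂} d₁ d₂) {Δ} {v} e with normalI-split-at-· k ½ Γ (½ · Δ₀) e
  ... | mkScaledSplit {Δ₁} {Δ₂} {v₁} {v₂} e₁ e₂ ctx wt s≡ with normalI-unscale ½ (at k Δ₀) e₂ (at-· k ½ Δ₀)
  ... | mkNormalIUnscaled {Δ₂'} {v₂'} e₂' c₂ wt₂ s₂' with subst⊢ k d₁ e₁ | subst⊢ k d₂ e₂'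
  ... | d₁' , s₁ | d₂' , s₂ = castWeight weight≡ typing ,
        NP.≤-trans (NP.≤-reflexive (size-castWeight weight≡ typing))
          (s≤s (size-+-bound (size d₁) (size d₂) (sizeNormal e₁) (sizeNormal e₂') s₁ s₂
                             (Eq.trans (cong (sizeNormal e₁ N.+_) s₂') s≡)))
    where
    typing = conv (⊢⊕ d₁' d₂') (subst-ctx-·⊎ k ½ Γ (½ · Δ₀) Δ₁ (½ · Δ₂') Δ _ (≈C-reflexive (subst-ctx-· k ½ Δ₀ Δ₂'))
            (≈C-trans (⊎-cong (≈C-refl _) c₂) ctx)) (≈D-refl _)
    weight≡ : ½ Q.* (w₁ Q.+ v₁) Q.+ ½ Q.* (w₂ Q.+ v₂') Q.+ 1ℚ ≡ (½ Q.* w₁ Q.+ ½ Q.* w₂ Q.+ 1ℚ) Q.+ v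
    weight≡ rewrite wt | wt₂ = solve 4 (λ w₁ w₂ a b → con ½ :* (w₁ :+ a) :+ con ½ :* (w₂ :+ b) :+ con 1ℚ
                     := (con ½ :* w₁ :+ con ½ :* w₂ :+ con 1ℚ) :+ (con ½ :* a :+ con ½ :* b)) Eq.refl w₁ w₂ v₁ v₂'
  subst⊢ k (⊢let {Γ} {Θ₀} {vN} {u} dN br) {Δ} {v} e with normalI-split-at k Γ Θ₀ e
  ... | mkNormalISplit {Δ₁} {Δ₂} {v₁} {v₂} e₁ e₂ ctx wt s≡ with subst⊢ k dN e₁ | substBr k br e₂
  ... | dN' , s₁ | mkSubstitutedBranches {Θ'} {u'} br' cB wtB s₂ = castWeight weight≡ typing ,
        NP.≤-trans (NP.≤-reflexive (size-castWeight weight≡ typing))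
                   (s≤s (size-+-bound (size dN) (sizeBr br) (sizeNormal e₁) (sizeNormal e₂) s₁ s₂ s≡))
    where
    typing = conv (⊢let dN' br') (≈C-trans (⊎-cong (≈C-refl _) cB) (subst-ctx-⊎ k Γ Θ₀ Δ₁ Δ₂ Δ ctx)) (≈D-refl _)
    weight≡ : u' Q.+ (vN Q.+ v₁) Q.+ 1ℚ ≡ (u Q.+ vN Q.+ 1ℚ) Q.+ v
    weight≡ rewrite wtB | wt =
      solve 5 (λ u vN v₁ v₂ o → (u :+ v₂) :+ (vN :+ v₁) :+ o := (u :+ vN :+ o) :+ (v₁ :+ v₂)) Eq.refl u vN v₁ v₂ 1ℚ
  subst⊢ k (⊢val d) e with substI k d e
  ... | d' , s = ⊢val d' , s
  subst⊢ k (conv d c a) e with normalI-resp-≈I e (at-cong k (≈C-sym c))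
  ... | e' , s₀ with subst⊢ k d e'
  ... | d' , s = conv d' (⊎-cong (removeAt-cong k c) (≈C-refl _)) a , NP.≤-trans s (NP.≤-reflexive (cong (size d N.+_) s₀))

  substI : ∀ k {n} {Θ : Ctx (k N.+ suc n)} {w V₁ 𝓜} (d : Θ ⊢I w ∣ V₁ ∶ 𝓜) {Δ : Ctx n} {v : ℚ} {V : Val n}
        (e : NormalI Δ v V (at k Θ)) →
        Σ ((removeAt k Θ ⊎ nils++ k Δ) ⊢I (w Q.+ v) ∣ subV (extsⁿ k (single V)) V₁ ∶ 𝓜) λ d' → sizeI d' N.≤ sizeI d N.+ sizeNormal e
  substI k (⊢var {x} {𝓜} wf) e = substVar k x 𝓜 wf e
  substI k (⊢! b) e with substBang k b e
  ... | mkSubstitutedBang b' c wt s =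
    castWeightI wt (convI (⊢! b') c (≈I-refl _)) , NP.≤-trans (NP.≤-reflexive (size-castWeightI wt _)) s
  substI k (convI d c p) e with normalI-resp-≈I e (at-cong k (≈C-sym c))
  ... | e' , s₀ with substI k d e'
  ... | d' , s = convI d' (⊎-cong (removeAt-cong k c) (≈C-refl _)) p , NP.≤-trans s (NP.≤-reflexive (cong (sizeI d N.+_) s₀))

  substA : ∀ k {n} {Θ : Ctx (k N.+ suc n)} {w V₁ A} (d : Θ ⊢A w ∣ V₁ ∶ A) {Δ : Ctx n} {v : ℚ} {V : Val n}
        (e : NormalI Δ v V (at k Θ)) →
        Σ ((removeAt k Θ ⊎ nils++ k Δ) ⊢A (w Q.+ v) ∣ subV (extsⁿ k (single V)) V₁ ∶ A) λ d' → sizeA d' N.≤ sizeA d N.+ sizeNormal e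
  substA k (⊢λ {Γ} {w} {M} {𝓜} d) {Δ} {v} e with subst⊢ (suc k) d e
  ... | d' , s = castWeightA weight≡ (⊢λ (conv d' (≈I-reflexive (++-identityʳ 𝓜) VP.∷ ≈C-refl _) (≈D-refl _))) ,
                 NP.≤-trans (NP.≤-reflexive (size-castWeightA weight≡ _)) (s≤s s)
    where
    weight≡ : w Q.+ v Q.+ 1ℚ ≡ w Q.+ 1ℚ Q.+ v
    weight≡ = solve 3 (λ w v o → w :+ v :+ o := w :+ o :+ v) Eq.refl w v 1ℚ
  substA k (convA d c p) e with normalI-resp-≈I e (at-cong k (≈C-sym c))
  ... | e' , s₀ with substA k d e'
  ... | d' , s = convA d' (⊎-cong (removeAt-cong k c) (≈C-refl _)) p , NP.≤-trans s (NP.≤-reflexive (cong (sizeA d N.+_) s₀))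

  substBang : ∀ k {n} {Θ : Ctx (k N.+ suc n)} {w V₁ 𝓜} (b : Bang Θ w V₁ 𝓜) {Δ : Ctx n} {v : ℚ} {V : Val n}
        (e : NormalI Δ v V (at k Θ)) → SubstitutedBang k Θ w V₁ 𝓜 Δ v V (sizeBang b N.+ sizeNormal e)
  substBang k bnil e with normalI-at-∅ k e
  ... | c , Eq.refl = mkSubstitutedBang bnil (subst-ctx-∅ k c) (Eq.sym (QP.+-identityˡ 0ℚ)) z≤n
  substBang k (bcons {Γ} {Δ₀} {w} {v₀} q iu dA b) {Δ} {v} e with normalI-split-at-· k q Γ Δ₀ e
  ... | mkScaledSplit {Δ₁} {Δ₂} {v₁} {v₂} e₁ e₂ ctx wt s≡ with substA k dA e₁ | substBang k b e₂
  ... | dA' , s₁ | mkSubstitutedBang {Γ''} b' cB wtB s₂ =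
        mkSubstitutedBang (bcons q iu dA' b') (subst-ctx-·⊎ k q Γ Δ₀ Δ₁ Δ₂ Δ Γ'' cB ctx)
          (Eq.trans (cong (q Q.* (w Q.+ v₁) Q.+_) wtB) (subst-weight-·⊎ q w v₁ v₀ v₂ wt))
          (size-+-bound (sizeA dA) (sizeBang b) (sizeNormal e₁) (sizeNormal e₂) s₁ s₂ s≡)

  substBr : ∀ k {n} {Θ : Ctx (k N.+ suc n)} {u M a c} (b : Branches Θ u M a c) {Δ : Ctx n} {v : ℚ} {V : Val n}
        (e : NormalI Δ v V (at k Θ)) → SubstitutedBranches k Θ u M a c Δ v V (sizeBr b N.+ sizeNormal e)
  substBr k brnil e with normalI-at-∅ k e
  ... | c , Eq.refl = mkSubstitutedBranches brnil (subst-ctx-∅ k c) (Eq.sym (QP.+-identityˡ 0ℚ)) z≤n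
  substBr k (brcons {Δb} {Θ₀} {w} {u} {M} {p} {𝓜} d b) {Δ} {v} e with normalI-split-at-· k p Δb Θ₀ e
  ... | mkScaledSplit {Δ₁} {Δ₂} {v₁} {v₂} e₁ e₂ ctx wt s≡ with subst⊢ (suc k) d e₁ | substBr k b e₂
  ... | d' , s₁ | mkSubstitutedBranches {Θ''} b' cB wtB s₂ =
        mkSubstitutedBranches (brcons (conv d' (≈I-reflexive (++-identityʳ 𝓜) VP.∷ ≈C-refl _) (≈D-refl _)) b')
          (subst-ctx-·⊎ k p Δb Θ₀ Δ₁ Δ₂ Δ Θ'' cB ctx)
          (Eq.trans (cong (p Q.* (w Q.+ v₁) Q.+_) wtB) (subst-weight-·⊎ p w v₁ u v₂ wt))
          (size-+-bound (size d) (sizeBr b) (sizeNormal e₁) (sizeNormal e₂) s₁ s₂ s≡)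

-- Reduction of multidistributions

data NonValue : Tm 0 → Set where
  nv-app : ∀ {V W} → NonValue (app V W)
  nv-⊕ : ∀ {M N} → NonValue (M ⊕ N)
  nv-let : ∀ {N M} → NonValue (letin N M)

NonNeg : MDist → Set
NonNeg = All (λ e → 0ℚ ≤ proj₁ e)

mass : MDist → ℚ
mass [] = 0ℚ
mass ((p , _) ∷ m) = p Q.+ mass m

nonValueMass : MDist → ℚ
nonValueMass [] = 0ℚ
nonValueMass ((p , val V) ∷ m) = nonValueMass m
nonValueMass ((p , app _ _) ∷ m) = p Q.+ nonValueMass m
nonValueMass ((p , _ ⊕ _) ∷ m) = p Q.+ nonValueMass m
nonValueMass ((p , letin _ _) ∷ m) = p Q.+ nonValueMass m

nonNeg-+ : ∀ {p q} → 0ℚ ≤ p → 0ℚ ≤ q → 0ℚ ≤ p Q.+ q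
nonNeg-+ hp hq = QP.≤-trans (QP.≤-reflexive (Eq.sym (QP.+-identityˡ 0ℚ))) (QP.+-mono-≤ hp hq)

nonNeg-* : ∀ {p q} → 0ℚ ≤ p → 0ℚ ≤ q → 0ℚ ≤ p Q.* q
nonNeg-* {p} {q} hp hq = QP.nonNegative⁻¹ (p Q.* q) {{QP.nonNeg*nonNeg⇒nonNeg p {{Q.nonNegative hp}} q {{Q.nonNegative hq}}}}

*-monoʳ-≤-0≤ : ∀ {p a b} → 0ℚ ≤ p → a ≤ b → p Q.* a ≤ p Q.* b
*-monoʳ-≤-0≤ {p} hp = QP.*-monoˡ-≤-nonNeg p {{Q.nonNegative hp}}

p≤p+q : ∀ {p q} → 0ℚ ≤ q → p ≤ p Q.+ q
p≤p+q {p} hq = QP.≤-trans (QP.≤-reflexive (Eq.sym (QP.+-identityʳ p))) (QP.+-monoʳ-≤ p hq)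

valueMass-++ : ∀ a b → valueMass (a ++ b) ≡ valueMass a Q.+ valueMass b
valueMass-++ [] b = Eq.sym (QP.+-identityˡ _)
valueMass-++ ((p , val V) ∷ a) b = Eq.trans (cong (p Q.+_) (valueMass-++ a b)) (Eq.sym (QP.+-assoc p _ _))
valueMass-++ ((p , app _ _) ∷ a) b = valueMass-++ a b
valueMass-++ ((p , _ ⊕ _) ∷ a) b = valueMass-++ a b
valueMass-++ ((p , letin _ _) ∷ a) b = valueMass-++ a b

nonValueMass-++ : ∀ a b → nonValueMass (a ++ b) ≡ nonValueMass a Q.+ nonValueMass b
nonValueMass-++ [] b = Eq.sym (QP.+-identityˡ _)
nonValueMass-++ ((p , val V) ∷ a) b = nonValueMass-++ a b
nonValueMass-++ ((p , app _ _) ∷ a) b = Eq.trans (cong (p Q.+_) (nonValueMass-++ a b)) (Eq.sym (QP.+-assoc p _ _))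
nonValueMass-++ ((p , _ ⊕ _) ∷ a) b = Eq.trans (cong (p Q.+_) (nonValueMass-++ a b)) (Eq.sym (QP.+-assoc p _ _))
nonValueMass-++ ((p , letin _ _) ∷ a) b = Eq.trans (cong (p Q.+_) (nonValueMass-++ a b)) (Eq.sym (QP.+-assoc p _ _))

mass-++ : ∀ a b → mass (a ++ b) ≡ mass a Q.+ mass b
mass-++ [] b = Eq.sym (QP.+-identityˡ _)
mass-++ ((p , _) ∷ a) b = Eq.trans (cong (p Q.+_) (mass-++ a b)) (Eq.sym (QP.+-assoc p _ _))

valueMass-scaleM : ∀ p m → valueMass (scaleM p m) ≡ p Q.* valueMass m
valueMass-scaleM p [] = Eq.sym (QP.*-zeroʳ p)
valueMass-scaleM p ((q , val V) ∷ m) = Eq.trans (cong (p Q.* q Q.+_) (valueMass-scaleM p m)) (Eq.sym (QP.*-distribˡ-+ p q _))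
valueMass-scaleM p ((q , app _ _) ∷ m) = valueMass-scaleM p m
valueMass-scaleM p ((q , _ ⊕ _) ∷ m) = valueMass-scaleM p m
valueMass-scaleM p ((q , letin _ _) ∷ m) = valueMass-scaleM p m

nonValueMass-scaleM : ∀ p m → nonValueMass (scaleM p m) ≡ p Q.* nonValueMass m
nonValueMass-scaleM p [] = Eq.sym (QP.*-zeroʳ p)
nonValueMass-scaleM p ((q , val V) ∷ m) = nonValueMass-scaleM p m
nonValueMass-scaleM p ((q , app _ _) ∷ m) = Eq.trans (cong (p Q.* q Q.+_) (nonValueMass-scaleM p m)) (Eq.sym (QP.*-distribˡ-+ p q _))
nonValueMass-scaleM p ((q , _ ⊕ _) ∷ m) = Eq.trans (cong (p Q.* q Q.+_) (nonValueMass-scaleM p m)) (Eq.sym (QP.*-distribˡ-+ p q _))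
nonValueMass-scaleM p ((q , letin _ _) ∷ m) = Eq.trans (cong (p Q.* q Q.+_) (nonValueMass-scaleM p m)) (Eq.sym (QP.*-distribˡ-+ p q _))

mass-scaleM : ∀ p m → mass (scaleM p m) ≡ p Q.* mass m
mass-scaleM p [] = Eq.sym (QP.*-zeroʳ p)
mass-scaleM p ((q , _) ∷ m) = Eq.trans (cong (p Q.* q Q.+_) (mass-scaleM p m)) (Eq.sym (QP.*-distribˡ-+ p q _))

mass≡value+nonValue : ∀ m → mass m ≡ valueMass m Q.+ nonValueMass m
mass≡value+nonValue [] = Eq.sym (QP.+-identityˡ 0ℚ)
mass≡value+nonValue ((p , val V) ∷ m) = Eq.trans (cong (p Q.+_) (mass≡value+nonValue m)) (Eq.sym (QP.+-assoc p _ _))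
mass≡value+nonValue ((p , app _ _) ∷ m) = Eq.trans (cong (p Q.+_) (mass≡value+nonValue m)) (ℚ+.x∙yz≈y∙xz p (valueMass m) (nonValueMass m))
mass≡value+nonValue ((p , _ ⊕ _) ∷ m) = Eq.trans (cong (p Q.+_) (mass≡value+nonValue m)) (ℚ+.x∙yz≈y∙xz p (valueMass m) (nonValueMass m))
mass≡value+nonValue ((p , letin _ _) ∷ m) = Eq.trans (cong (p Q.+_) (mass≡value+nonValue m)) (ℚ+.x∙yz≈y∙xz p (valueMass m) (nonValueMass m))

NonNeg-++ : ∀ {a b} → NonNeg a → NonNeg b → NonNeg (a ++ b)
NonNeg-++ [] hb = hb
NonNeg-++ (h ∷ ha) hb = h ∷ NonNeg-++ ha hb

NonNeg-scaleM : ∀ {p} a → 0ℚ ≤ p → NonNeg a → NonNeg (scaleM p a)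
NonNeg-scaleM [] hp [] = []
NonNeg-scaleM (x ∷ a) hp (h ∷ ha) = nonNeg-* hp h ∷ NonNeg-scaleM a hp ha

valueMass-nonNeg : ∀ {m} → NonNeg m → 0ℚ ≤ valueMass m
valueMass-nonNeg [] = QP.≤-refl
valueMass-nonNeg {(p , val V) ∷ m} (h ∷ hs) = nonNeg-+ h (valueMass-nonNeg hs)
valueMass-nonNeg {(p , app _ _) ∷ m} (h ∷ hs) = valueMass-nonNeg hs
valueMass-nonNeg {(p , _ ⊕ _) ∷ m} (h ∷ hs) = valueMass-nonNeg hs
valueMass-nonNeg {(p , letin _ _) ∷ m} (h ∷ hs) = valueMass-nonNeg hs

nonValueMass-nonNeg : ∀ {m} → NonNeg m → 0ℚ ≤ nonValueMass m
nonValueMass-nonNeg [] = QP.≤-refl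
nonValueMass-nonNeg {(p , val V) ∷ m} (h ∷ hs) = nonValueMass-nonNeg hs
nonValueMass-nonNeg {(p , app _ _) ∷ m} (h ∷ hs) = nonNeg-+ h (nonValueMass-nonNeg hs)
nonValueMass-nonNeg {(p , _ ⊕ _) ∷ m} (h ∷ hs) = nonNeg-+ h (nonValueMass-nonNeg hs)
nonValueMass-nonNeg {(p , letin _ _) ∷ m} (h ∷ hs) = nonNeg-+ h (nonValueMass-nonNeg hs)

mapLet : Tm 1 → MDist → MDist
mapLet M = L.map (λ e → (proj₁ e , letin (proj₂ e) M))

mass-mapLet : ∀ M m → mass (mapLet M m) ≡ mass m
mass-mapLet M [] = Eq.refl
mass-mapLet M ((p , N) ∷ m) = cong (p Q.+_) (mass-mapLet M m)

NonNeg-mapLet : ∀ M {m} → NonNeg m → NonNeg (mapLet M m)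
NonNeg-mapLet M [] = []
NonNeg-mapLet M (h ∷ hs) = h ∷ NonNeg-mapLet M hs

mass-stepC : ∀ M → mass (stepC M) ≡ 1ℚ
mass-stepC (val V) = Eq.refl
mass-stepC (app (lam M) W) = Eq.refl
mass-stepC (M ⊕ N) = Eq.refl
mass-stepC (letin (val V) M) = Eq.refl
mass-stepC (letin (app V W) M) = Eq.trans (mass-mapLet M (stepC (app V W))) (mass-stepC (app V W))
mass-stepC (letin (N₁ ⊕ N₂) M) = Eq.trans (mass-mapLet M (stepC (N₁ ⊕ N₂))) (mass-stepC (N₁ ⊕ N₂))
mass-stepC (letin (letin N₁ N₂) M) = Eq.trans (mass-mapLet M (stepC (letin N₁ N₂))) (mass-stepC (letin N₁ N₂))

NonNeg-stepC : ∀ M → NonNeg (stepC M)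
NonNeg-stepC (val V) = QP.nonNegative⁻¹ 1ℚ ∷ []
NonNeg-stepC (app (lam M) W) = QP.nonNegative⁻¹ 1ℚ ∷ []
NonNeg-stepC (M ⊕ N) = QP.nonNegative⁻¹ ½ ∷ QP.nonNegative⁻¹ ½ ∷ []
NonNeg-stepC (letin (val V) M) = QP.nonNegative⁻¹ 1ℚ ∷ []
NonNeg-stepC (letin (app V W) M) = NonNeg-mapLet M (NonNeg-stepC (app V W))
NonNeg-stepC (letin (N₁ ⊕ N₂) M) = NonNeg-mapLet M (NonNeg-stepC (N₁ ⊕ N₂))
NonNeg-stepC (letin (letin N₁ N₂) M) = NonNeg-mapLet M (NonNeg-stepC (letin N₁ N₂))

liftStep-++ : ∀ a b → liftStep (a ++ b) ≡ liftStep a ++ liftStep b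
liftStep-++ [] b = Eq.refl
liftStep-++ ((p , M) ∷ a) b =
  Eq.trans (cong (scaleM p (stepC M) ++_) (liftStep-++ a b)) (Eq.sym (++-assoc (scaleM p (stepC M)) _ _))

liftStep-scaleM : ∀ p a → liftStep (scaleM p a) ≡ scaleM p (liftStep a)
liftStep-scaleM p [] = Eq.refl
liftStep-scaleM p ((q , M) ∷ a) = Eq.trans (cong₂ _++_ (Eq.sym (scale-scale p q (stepC M))) (liftStep-scaleM p a))
  (Eq.sym (scale-++ p (scaleM q (stepC M)) _))

liftStep-single : ∀ M → liftStep ((1ℚ , M) ∷ []) ≡ stepC M
liftStep-single M = Eq.trans (++-identityʳ _) (scale-1 (stepC M))

NonNeg-liftStep : ∀ {m} → NonNeg m → NonNeg (liftStep m)
NonNeg-liftStep [] = []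
NonNeg-liftStep {(p , M) ∷ m} (h ∷ hs) = NonNeg-++ (NonNeg-scaleM (stepC M) h (NonNeg-stepC M)) (NonNeg-liftStep hs)

mass-liftStep : ∀ m → mass (liftStep m) ≡ mass m
mass-liftStep [] = Eq.refl
mass-liftStep ((p , M) ∷ m) = Eq.trans (mass-++ (scaleM p (stepC M)) (liftStep m))
  (cong₂ Q._+_ (Eq.trans (mass-scaleM p (stepC M)) (Eq.trans (cong (p Q.*_) (mass-stepC M)) (QP.*-identityʳ p))) (mass-liftStep m))

valueMass-≤-stepC : ∀ {p} M → 0ℚ ≤ p → valueMass ((p , M) ∷ []) ≤ valueMass (scaleM p (stepC M))
valueMass-≤-stepC {p} (val V) h = QP.≤-reflexive (cong (Q._+ 0ℚ) (Eq.sym (QP.*-identityʳ p)))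
valueMass-≤-stepC (app V W) h = valueMass-nonNeg (NonNeg-scaleM _ h (NonNeg-stepC (app V W)))
valueMass-≤-stepC (M ⊕ N) h = valueMass-nonNeg (NonNeg-scaleM _ h (NonNeg-stepC (M ⊕ N)))
valueMass-≤-stepC (letin N M) h = valueMass-nonNeg (NonNeg-scaleM _ h (NonNeg-stepC (letin N M)))

valueMass-liftStep-mono : ∀ {m} → NonNeg m → valueMass m ≤ valueMass (liftStep m)
valueMass-liftStep-mono [] = QP.≤-refl
valueMass-liftStep-mono {(p , M) ∷ m} (h ∷ hs) = begin
  valueMass ((p , M) ∷ m)                                   ≡⟨ valueMass-++ ((p , M) ∷ []) m ⟩
  valueMass ((p , M) ∷ []) Q.+ valueMass m                  ≤⟨ QP.+-mono-≤ (valueMass-≤-stepC M h) (valueMass-liftStep-mono hs) ⟩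
  valueMass (scaleM p (stepC M)) Q.+ valueMass (liftStep m) ≡⟨ Eq.sym (valueMass-++ (scaleM p (stepC M)) (liftStep m)) ⟩
  valueMass (liftStep ((p , M) ∷ m))                        ∎
  where open QP.≤-Reasoning

liftStepⁿ : ℕ → MDist → MDist
liftStepⁿ zero m = m
liftStepⁿ (suc k) m = liftStepⁿ k (liftStep m)

liftStepⁿ-suc : ∀ k m → liftStepⁿ k (liftStep m) ≡ liftStep (liftStepⁿ k m)
liftStepⁿ-suc zero m = Eq.refl
liftStepⁿ-suc (suc k) m = liftStepⁿ-suc k (liftStep m)

mseq≡liftStepⁿ : ∀ M k → mseq M k ≡ liftStepⁿ k ((1ℚ , M) ∷ [])
mseq≡liftStepⁿ M zero = Eq.refl
mseq≡liftStepⁿ M (suc k) = Eq.trans (cong liftStep (mseq≡liftStepⁿ M k)) (Eq.sym (liftStepⁿ-suc k _))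

liftStepⁿ-++ : ∀ k a b → liftStepⁿ k (a ++ b) ≡ liftStepⁿ k a ++ liftStepⁿ k b
liftStepⁿ-++ zero a b = Eq.refl
liftStepⁿ-++ (suc k) a b = Eq.trans (cong (liftStepⁿ k) (liftStep-++ a b)) (liftStepⁿ-++ k (liftStep a) (liftStep b))

liftStepⁿ-scaleM : ∀ k p a → liftStepⁿ k (scaleM p a) ≡ scaleM p (liftStepⁿ k a)
liftStepⁿ-scaleM zero p a = Eq.refl
liftStepⁿ-scaleM (suc k) p a = Eq.trans (cong (liftStepⁿ k) (liftStep-scaleM p a)) (liftStepⁿ-scaleM k p (liftStep a))

NonNeg-liftStepⁿ : ∀ k {m} → NonNeg m → NonNeg (liftStepⁿ k m)
NonNeg-liftStepⁿ zero h = h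
NonNeg-liftStepⁿ (suc k) h = NonNeg-liftStepⁿ k (NonNeg-liftStep h)

mass-liftStepⁿ : ∀ k m → mass (liftStepⁿ k m) ≡ mass m
mass-liftStepⁿ zero m = Eq.refl
mass-liftStepⁿ (suc k) m = Eq.trans (mass-liftStepⁿ k (liftStep m)) (mass-liftStep m)

𝒫ᴹ : ℕ → MDist → ℚ
𝒫ᴹ k m = valueMass (liftStepⁿ k m)

ℰᴹ : ℕ → MDist → ℚ
ℰᴹ zero m = 0ℚ
ℰᴹ (suc k) m = nonValueMass m Q.+ ℰᴹ k (liftStep m)

ℰᴹ-suc : ∀ k m → ℰᴹ (suc k) m ≡ ℰᴹ k m Q.+ nonValueMass (liftStepⁿ k m)
ℰᴹ-suc zero m = Eq.trans (QP.+-identityʳ (nonValueMass m)) (Eq.sym (QP.+-identityˡ (nonValueMass m)))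
ℰᴹ-suc (suc k) m = Eq.trans (cong (nonValueMass m Q.+_) (ℰᴹ-suc k (liftStep m)))
  (Eq.sym (QP.+-assoc (nonValueMass m) (ℰᴹ k (liftStep m)) (nonValueMass (liftStepⁿ k (liftStep m)))))

𝒫ᴹ-mono-suc : ∀ k {m} → NonNeg m → 𝒫ᴹ k m ≤ 𝒫ᴹ (suc k) m
𝒫ᴹ-mono-suc k {m} h =
  QP.≤-trans (valueMass-liftStep-mono (NonNeg-liftStepⁿ k h)) (QP.≤-reflexive (cong valueMass (Eq.sym (liftStepⁿ-suc k m))))

ℰᴹ-mono-suc : ∀ k {m} → NonNeg m → ℰᴹ k m ≤ ℰᴹ (suc k) m
ℰᴹ-mono-suc k {m} h = QP.≤-trans (p≤p+q (nonValueMass-nonNeg (NonNeg-liftStepⁿ k h))) (QP.≤-reflexive (Eq.sym (ℰᴹ-suc k m)))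

𝒫ᴹ-mono : ∀ {k k'} {m} → NonNeg m → k N.≤′ k' → 𝒫ᴹ k m ≤ 𝒫ᴹ k' m
𝒫ᴹ-mono h N.≤′-refl = QP.≤-refl
𝒫ᴹ-mono {k' = suc k'} h (N.≤′-step le) = QP.≤-trans (𝒫ᴹ-mono h le) (𝒫ᴹ-mono-suc k' h)

ℰᴹ-mono : ∀ {k k'} {m} → NonNeg m → k N.≤′ k' → ℰᴹ k m ≤ ℰᴹ k' m
ℰᴹ-mono h N.≤′-refl = QP.≤-refl
ℰᴹ-mono {k' = suc k'} h (N.≤′-step le) = QP.≤-trans (ℰᴹ-mono h le) (ℰᴹ-mono-suc k' h)

𝒫ᴹ-++ : ∀ k a b → 𝒫ᴹ k (a ++ b) ≡ 𝒫ᴹ k a Q.+ 𝒫ᴹ k b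
𝒫ᴹ-++ k a b = Eq.trans (cong valueMass (liftStepⁿ-++ k a b)) (valueMass-++ (liftStepⁿ k a) (liftStepⁿ k b))

ℰᴹ-++ : ∀ k a b → ℰᴹ k (a ++ b) ≡ ℰᴹ k a Q.+ ℰᴹ k b
ℰᴹ-++ zero a b = Eq.sym (QP.+-identityˡ 0ℚ)
ℰᴹ-++ (suc k) a b = Eq.trans
  (cong₂ Q._+_ (nonValueMass-++ a b) (Eq.trans (cong (ℰᴹ k) (liftStep-++ a b)) (ℰᴹ-++ k (liftStep a) (liftStep b))))
  (ℚ+.interchange (nonValueMass a) (nonValueMass b) (ℰᴹ k (liftStep a)) (ℰᴹ k (liftStep b)))

𝒫ᴹ-scaleM : ∀ k p a → 𝒫ᴹ k (scaleM p a) ≡ p Q.* 𝒫ᴹ k a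
𝒫ᴹ-scaleM k p a = Eq.trans (cong valueMass (liftStepⁿ-scaleM k p a)) (valueMass-scaleM p (liftStepⁿ k a))

ℰᴹ-scaleM : ∀ k p a → ℰᴹ k (scaleM p a) ≡ p Q.* ℰᴹ k a
ℰᴹ-scaleM zero p a = Eq.sym (QP.*-zeroʳ p)
ℰᴹ-scaleM (suc k) p a = Eq.trans
  (cong₂ Q._+_ (nonValueMass-scaleM p a) (Eq.trans (cong (ℰᴹ k) (liftStep-scaleM p a)) (ℰᴹ-scaleM k p (liftStep a))))
  (Eq.sym (QP.*-distribˡ-+ p (nonValueMass a) _))

-- Reduction preserves total mass, so the paper's 1 − 𝒫ⱼ(M) is the non-value mass of mⱼ.
1-𝒫≡nonValueMass : ∀ M k → 1ℚ Q.- 𝒫 k M ≡ nonValueMass (liftStepⁿ k ((1ℚ , M) ∷ []))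
1-𝒫≡nonValueMass M k = begin
  1ℚ Q.- 𝒫 k M                                      ≡⟨ cong₂ Q._-_ total (cong valueMass (mseq≡liftStepⁿ M k)) ⟩
  (valueMass x Q.+ nonValueMass x) Q.- valueMass x  ≡⟨ solve 2 (λ a b → (a :+ b) :- a := b) Eq.refl (valueMass x) (nonValueMass x) ⟩
  nonValueMass x                                    ∎
  where
  open Eq.≡-Reasoning
  x = liftStepⁿ k ((1ℚ , M) ∷ [])
  total : 1ℚ ≡ valueMass x Q.+ nonValueMass x
  total = Eq.trans (Eq.sym (Eq.trans (mass-liftStepⁿ k _) (QP.+-identityʳ 1ℚ))) (mass≡value+nonValue x)

ℰ≡ℰᴹ : ∀ M k → ℰ k M ≡ ℰᴹ k ((1ℚ , M) ∷ [])
ℰ≡ℰᴹ M zero = Eq.refl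
ℰ≡ℰᴹ M (suc k) = Eq.trans (cong₂ Q._+_ (ℰ≡ℰᴹ M k) (1-𝒫≡nonValueMass M k)) (Eq.sym (ℰᴹ-suc k _))

Attains : MDist → ℚ → ℚ → Set
Attains m w b = ∃ λ k → (b ≤ 𝒫ᴹ k m) × (w ≤ ℰᴹ k m)

attains⇒𝒫ℰ : ∀ M {w b} → Attains ((1ℚ , M) ∷ []) w b → ∃[ k ] ((b ≤ 𝒫 k M) × (w ≤ ℰ k M))
attains⇒𝒫ℰ M (k , g₁ , g₂) = k , QP.≤-trans g₁ (QP.≤-reflexive (cong valueMass (Eq.sym (mseq≡liftStepⁿ M k))))
                              , QP.≤-trans g₂ (QP.≤-reflexive (Eq.sym (ℰ≡ℰᴹ M k)))

attains-later : ∀ {m w b} → NonNeg m → ∀ {k k'} → k N.≤ k' →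
  (b ≤ 𝒫ᴹ k m) × (w ≤ ℰᴹ k m) → (b ≤ 𝒫ᴹ k' m) × (w ≤ ℰᴹ k' m)
attains-later h le (p , q) = QP.≤-trans p (𝒫ᴹ-mono h (NP.≤⇒≤′ le)) , QP.≤-trans q (ℰᴹ-mono h (NP.≤⇒≤′ le))

attains-++ : ∀ {a b w₁ w₂ b₁ b₂} → NonNeg a → NonNeg b →
  Attains a w₁ b₁ → Attains b w₂ b₂ → Attains (a ++ b) (w₁ Q.+ w₂) (b₁ Q.+ b₂)
attains-++ {a} {b} ha hb (k₁ , g₁) (k₂ , g₂)
  with attains-later ha (NP.m≤m⊔n k₁ k₂) g₁ | attains-later hb (NP.m≤n⊔m k₁ k₂) g₂
... | p₁ , q₁ | p₂ , q₂ = k₁ N.⊔ k₂ , QP.≤-trans (QP.+-mono-≤ p₁ p₂) (QP.≤-reflexive (Eq.sym (𝒫ᴹ-++ (k₁ N.⊔ k₂) a b)))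
                                    , QP.≤-trans (QP.+-mono-≤ q₁ q₂) (QP.≤-reflexive (Eq.sym (ℰᴹ-++ (k₁ N.⊔ k₂) a b)))

attains-scaleM : ∀ {p m w b} → 0ℚ ≤ p → Attains m w b → Attains (scaleM p m) (p Q.* w) (p Q.* b)
attains-scaleM {p} {m} hp (k , g₁ , g₂) =
  k , QP.≤-trans (*-monoʳ-≤-0≤ hp g₁) (QP.≤-reflexive (Eq.sym (𝒫ᴹ-scaleM k p m)))
    , QP.≤-trans (*-monoʳ-≤-0≤ hp g₂) (QP.≤-reflexive (Eq.sym (ℰᴹ-scaleM k p m)))

attains-weaken : ∀ {m w b w' b'} → w' ≤ w → b' ≤ b → Attains m w b → Attains m w' b'
attains-weaken w b (k , g₁ , g₂) = k , QP.≤-trans b g₁ , QP.≤-trans w g₂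

attains-zero : ∀ {m} → NonNeg m → Attains m 0ℚ 0ℚ
attains-zero h = 0 , valueMass-nonNeg h , QP.≤-refl

attains-value : ∀ {V} → Attains ((1ℚ , val V) ∷ []) 0ℚ 1ℚ
attains-value = 0 , QP.≤-refl , QP.≤-refl

nonValueMass-single : ∀ {M} → NonValue M → nonValueMass ((1ℚ , M) ∷ []) ≡ 1ℚ
nonValueMass-single nv-app = Eq.refl
nonValueMass-single nv-⊕ = Eq.refl
nonValueMass-single nv-let = Eq.refl

attains-step : ∀ {M w b} → NonValue M → Attains (stepC M) w b → Attains ((1ℚ , M) ∷ []) (w Q.+ 1ℚ) b
attains-step {M} nv (k , g₁ , g₂) = suc k ,
  QP.≤-trans g₁ (QP.≤-reflexive (cong (λ z → valueMass (liftStepⁿ k z)) (Eq.sym (liftStep-single M)))) ,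
  QP.≤-trans (QP.+-mono-≤ g₂ QP.≤-refl) (QP.≤-reflexive (Eq.trans (QP.+-comm (ℰᴹ k (stepC M)) 1ℚ)
     (cong₂ Q._+_ (Eq.sym (nonValueMass-single nv)) (cong (ℰᴹ k) (Eq.sym (liftStep-single M))))))

mutual
  norm-perm : ∀ {a b} → Permutation _≈[I]_ a b → norm a ≡ norm b
  norm-perm (refl p) = norm-pointwise p
  norm-perm (prep (e , _) p) = cong₂ Q._+_ e (norm-perm p)
  norm-perm {(x , _) ∷ (y , _) ∷ xs} {_ ∷ _ ∷ ys} (swap (e₁ , _) (e₂ , _) p) =
    Eq.trans (ℚ+.x∙yz≈y∙xz x y (norm xs))
             (cong₂ Q._+_ e₂ (cong₂ Q._+_ e₁ (norm-perm p)))
  norm-perm (trans p q) = Eq.trans (norm-perm p) (norm-perm q)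

  norm-pointwise : ∀ {a b} → Pointwise _≈[I]_ a b → norm a ≡ norm b
  norm-pointwise [] = Eq.refl
  norm-pointwise ((e , _) ∷ p) = cong₂ Q._+_ e (norm-pointwise p)

norm-≈ : ∀ {a b} → a ≈D b → norm a ≡ norm b
norm-≈ (permD p) = norm-perm p

Tight-resp-≈D : ∀ {a b} → a ≈D b → Tight a → Tight b
Tight-resp-≈D (permD p) t = PermI.All-resp-↭ (λ { (_ , i) e → ≈I-[] (Eq.subst (_≈I _) e i) }) p t

norm-scaleD-++ : ∀ p a A → norm (scaleD p a ++ A) ≡ p Q.* norm a Q.+ norm A
norm-scaleD-++ p [] A = Eq.sym (Eq.trans (cong (Q._+ norm A) (QP.*-zeroʳ p)) (QP.+-identityˡ _))
norm-scaleD-++ p ((q , _) ∷ a) A = Eq.trans (cong (p Q.* q Q.+_) (norm-scaleD-++ p a A))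
  (solve 4 (λ p q x y → p :* q :+ (p :* x :+ y) := p :* (q :+ x) :+ y) Eq.refl p q (norm a) (norm A))

Tight-scaleD-++⁻ : ∀ p a {A} → Tight (scaleD p a ++ A) → Tight a × Tight A
Tight-scaleD-++⁻ p [] t = [] , t
Tight-scaleD-++⁻ p (x ∷ a) (h ∷ t) with Tight-scaleD-++⁻ p a t
... | t₁ , t₂ = h ∷ t₁ , t₂

record Branches≈ {n} (Θ : Ctx n) (u : ℚ) (M : Tm (suc n)) (a' c : TDist) (s : ℕ) : Set where
  constructor mkBranches≈
  field
    {Θ'} : Ctx n
    {u'} : ℚ
    {c'} : TDist
    b : Branches Θ' u' M a' c'
    wt : u' ≡ u
    cc : c ≈D c'
    s≡ : sizeBr b ≡ s

branches≈-cons : ∀ {Θ Δ : Ctx 0} {w u M p 𝓜 𝓜' a a' b c} (d : (𝓜 ∷ Δ) ⊢ w ∣ M ∶ b) (b₀ : Branches Θ u M a c) → 𝓜 ≈I 𝓜' →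
  Branches≈ Θ u M a' c (sizeBr b₀) → Branches≈ ((p · Δ) ⊎ Θ) (p Q.* w Q.+ u) M ((p , 𝓜') ∷ a') (scaleD p b ++ c) (sizeBr (brcons {p = p} d b₀))
branches≈-cons {w = w} {p = p} {b = bt} d b₀ i (mkBranches≈ b' wt cc s≡) =
  mkBranches≈ (brcons (conv d (i VP.∷ ≈C-closed _ []) (≈D-refl bt)) b') (cong (p Q.* w Q.+_) wt)
    (≈D-++ (≈D-refl (scaleD p bt)) cc) (cong (size d N.+_) s≡)

branches≈-swap : ∀ {Θ Δ₁ Δ₂ : Ctx 0} {w₁ w₂ u₀ M p₁ p₂ 𝓜₁ 𝓜₁' 𝓜₂ 𝓜₂' a a' b₁ b₂ c₀}
  (d₁ : (𝓜₁ ∷ Δ₁) ⊢ w₁ ∣ M ∶ b₁) (d₂ : (𝓜₂ ∷ Δ₂) ⊢ w₂ ∣ M ∶ b₂) (b : Branches Θ u₀ M a c₀) →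
  𝓜₁ ≈I 𝓜₁' → 𝓜₂ ≈I 𝓜₂' → Branches≈ Θ u₀ M a' c₀ (sizeBr b) →
  Branches≈ ((p₁ · Δ₁) ⊎ ((p₂ · Δ₂) ⊎ Θ)) (p₁ Q.* w₁ Q.+ (p₂ Q.* w₂ Q.+ u₀)) M ((p₂ , 𝓜₂') ∷ (p₁ , 𝓜₁') ∷ a')
      (scaleD p₁ b₁ ++ (scaleD p₂ b₂ ++ c₀)) (sizeBr (brcons {p = p₁} d₁ (brcons {p = p₂} d₂ b)))
branches≈-swap {w₁ = w₁} {w₂} {u₀} {p₁ = p₁} {p₂} {b₁ = b₁} {b₂} d₁ d₂ b i₁ i₂ (mkBranches≈ b' wt cc s≡) =
    mkBranches≈ (brcons (conv d₂ (i₂ VP.∷ ≈C-closed _ []) (≈D-refl b₂))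
                  (brcons (conv d₁ (i₁ VP.∷ ≈C-closed _ []) (≈D-refl b₁)) b'))
      (Eq.trans (cong (λ z → p₂ Q.* w₂ Q.+ (p₁ Q.* w₁ Q.+ z)) wt)
         (solve 5 (λ a b c d e → b :* d :+ (a :* c :+ e) := a :* c :+ (b :* d :+ e)) Eq.refl p₁ p₂ w₁ w₂ u₀))
      (≈D-trans (permD (PermI.shifts (scaleD p₁ b₁) (scaleD p₂ b₂)))
                (≈D-++ (≈D-refl (scaleD p₂ b₂)) (≈D-++ (≈D-refl (scaleD p₁ b₁)) cc)))
      (Eq.trans (cong (λ z → size d₂ N.+ (size d₁ N.+ z)) s≡)
        (ℕ+.x∙yz≈y∙xz (size d₂) (size d₁) (sizeBr b)))

mutual
  branches-perm : ∀ {Θ : Ctx 0} {u M a a' c} (b : Branches Θ u M a c) → Permutation _≈[I]_ a a' →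
    Branches≈ Θ u M a' c (sizeBr b)
  branches-perm b (refl p) = branches-pointwise b p
  branches-perm (brcons d b) (prep (Eq.refl , i) p) = branches≈-cons d b i (branches-perm b p)
  branches-perm (brcons d₁ (brcons d₂ b)) (swap (Eq.refl , i₁) (Eq.refl , i₂) p) =
    branches≈-swap d₁ d₂ b i₁ i₂ (branches-perm b p)
  branches-perm b (trans p q) with branches-perm b p
  ... | mkBranches≈ b' wt cc s≡ with branches-perm b' q
  ... | mkBranches≈ b'' wt' cc' s≡' = mkBranches≈ b'' (Eq.trans wt' wt) (≈D-trans cc cc') (Eq.trans s≡' s≡)

  branches-pointwise : ∀ {Θ : Ctx 0} {u M a a' c} (b : Branches Θ u M a c) → Pointwise _≈[I]_ a a' →
    Branches≈ Θ u M a' c (sizeBr b)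
  branches-pointwise brnil [] = mkBranches≈ brnil Eq.refl (≈D-refl _) Eq.refl
  branches-pointwise (brcons d b) ((Eq.refl , i) ∷ p) = branches≈-cons d b i (branches-pointwise b p)

branches-resp-≈D : ∀ {Θ : Ctx 0} {u M a a' c} (b : Branches Θ u M a c) → a ≈D a' →
  Branches≈ Θ u M a' c (sizeBr b)
branches-resp-≈D b (permD p) = branches-perm b p

record BranchesSplit {n} (Θ : Ctx n) (u : ℚ) (M : Tm (suc n)) (a₁ a₂ c : TDist) (s : ℕ) : Set where
  constructor mkBranchesSplit
  field
    {Θ₁ Θ₂} : Ctx n
    {u₁ u₂} : ℚ
    {c₁ c₂} : TDist
    b₁ : Branches Θ₁ u₁ M a₁ c₁
    b₂ : Branches Θ₂ u₂ M a₂ c₂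
    wt : u ≡ u₁ Q.+ u₂
    cc : c ≡ c₁ ++ c₂
    s≡ : sizeBr b₁ N.+ sizeBr b₂ ≡ s

branches-split : ∀ {n} {Θ : Ctx n} {u M} a₁ {a₂ c} (b : Branches Θ u M (a₁ ++ a₂) c) →
  BranchesSplit Θ u M a₁ a₂ c (sizeBr b)
branches-split [] b = mkBranchesSplit brnil b (Eq.sym (QP.+-identityˡ _)) Eq.refl Eq.refl
branches-split (x ∷ a₁) (brcons {w = w} {p = p} {b = bt} d b) with branches-split a₁ b
... | mkBranchesSplit {u₁ = u₁} {u₂} {c₁} {c₂} b₁ b₂ wt cc s≡ =
  mkBranchesSplit (brcons d b₁) b₂ (Eq.trans (cong (p Q.* w Q.+_) wt) (Eq.sym (QP.+-assoc (p Q.* w) u₁ u₂)))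
    (Eq.trans (cong (scaleD p bt ++_) cc) (Eq.sym (++-assoc (scaleD p bt) c₁ c₂)))
    (Eq.trans (NP.+-assoc (size d) (sizeBr b₁) (sizeBr b₂)) (cong (size d N.+_) s≡))

record BranchesUnscaled {n} (Θ : Ctx n) (u : ℚ) (M : Tm (suc n)) (p : ℚ) (a' c : TDist) (s : ℕ) : Set where
  constructor mkBranchesUnscaled
  field
    {Θ'} : Ctx n
    {u'} : ℚ
    {c'} : TDist
    b : Branches Θ' u' M a' c'
    wt : u ≡ p Q.* u'
    cc : c ≡ scaleD p c'
    s≡ : sizeBr b ≡ s

branches-unscale : ∀ {n} {Θ : Ctx n} {u M a c} p a' (b : Branches Θ u M a c) → a ≡ scaleD p a' →
  BranchesUnscaled Θ u M p a' c (sizeBr b)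
branches-unscale p [] brnil Eq.refl = mkBranchesUnscaled brnil (Eq.sym (QP.*-zeroʳ p)) Eq.refl Eq.refl
branches-unscale p ((r , 𝓜) ∷ a') (brcons {w = w} {b = bt} d b) Eq.refl with branches-unscale p a' b Eq.refl
... | mkBranchesUnscaled {u' = u'} {c'} b' wt cc s≡ =
  mkBranchesUnscaled (brcons d b') (Eq.trans (cong ((p Q.* r) Q.* w Q.+_) wt)
          (solve 4 (λ p r w u → (p :* r) :* w :+ p :* u := p :* (r :* w :+ u)) Eq.refl p r w u'))
        (Eq.trans (cong₂ _++_ (Eq.sym (scale-scale p r bt)) cc) (Eq.sym (scale-++ p (scaleD r bt) c')))
        (cong (size d N.+_) s≡)

data TypedMDist (s : ℕ) : MDist → ℚ → TDist → Set where
  tnil : TypedMDist s [] 0ℚ []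
  tcons : ∀ {p M w a m W A} → 0ℚ ≤ p → (d : [] ⊢ w ∣ M ∶ a) → size d N.< s → TypedMDist s m W A →
          TypedMDist s ((p , M) ∷ m) (p Q.* w Q.+ W) (scaleD p a ++ A)

NonNeg-typed : ∀ {s m W A} → TypedMDist s m W A → NonNeg m
NonNeg-typed tnil = []
NonNeg-typed (tcons h d _ t) = h ∷ NonNeg-typed t

-- Every let-reduct pays 1 for its own rule (let), hence the term mass m.
record TypedLet (s : ℕ) (m : MDist) (W : ℚ) (M : Tm 1) (u : ℚ) (c : TDist) : Set where
  constructor mkTypedLet
  field
    {W'} : ℚ
    {C} : TDist
    ts : TypedMDist s (mapLet M m) W' C
    cc : c ≈D C
    wt : W' ≡ u Q.+ W Q.+ mass m

typed-let : ∀ {s m W A} sb {Θ : Ctx 0} {u M c} → TypedMDist s m W A → (b : Branches Θ u M A c) →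
  sizeBr b N.≤ sb → TypedLet (suc (s N.+ sb)) m W M u c
typed-let sb tnil brnil le = mkTypedLet tnil (≈D-refl _) (Eq.sym (Eq.trans (QP.+-identityʳ _) (QP.+-identityʳ 0ℚ)))
typed-let {s} sb {u = u} (tcons {p} {N} {w} {a} {m} {W} {A} h d lt ts) b le with branches-split (scaleD p a) b
... | mkBranchesSplit {u₁ = u₁} {u₂} b₁ b₂ wt cc s≡ with branches-unscale p a b₁ Eq.refl
... | mkBranchesUnscaled {u' = u₁'} {c₁'} b₁' wt₁ cc₁ s₁
  with typed-let sb ts b₂ (NP.≤-trans (NP.m≤n+m (sizeBr b₂) (sizeBr b₁)) (NP.≤-trans (NP.≤-reflexive s≡) le))
... | mkTypedLet {W''} {C''} ts' cc' wt' =
  mkTypedLet (tcons h let-typing (s≤s lt') ts')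
    (Eq.subst (λ z → z ≈D (scaleD p _ ++ C'')) (Eq.sym (Eq.trans cc (cong (_++ _) cc₁))) (≈D-++ (≈D-refl _) cc'))
    weight≡
  where
  let-typing = conv (⊢let d b₁') (≈C-closed _ _) (≈D-refl _)
  lt' : suc (size d N.+ sizeBr b₁') N.≤ s N.+ sb
  lt' = NP.+-mono-≤ lt (NP.≤-trans (NP.≤-reflexive s₁)
          (NP.≤-trans (NP.m≤m+n (sizeBr b₁) (sizeBr b₂)) (NP.≤-trans (NP.≤-reflexive s≡) le)))
  weight≡ : p Q.* (u₁' Q.+ w Q.+ 1ℚ) Q.+ W'' ≡ u Q.+ (p Q.* w Q.+ W) Q.+ (p Q.+ mass m)
  weight≡ rewrite wt | wt₁ | wt' = solve 6 (λ p u₁ w u₂ W ms → p :* (u₁ :+ w :+ con 1ℚ) :+ (u₂ :+ W :+ ms)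
       := (p :* u₁ :+ u₂) :+ (p :* w :+ W) :+ (p :+ ms)) Eq.refl p u₁' w u₂ W (mass m)

typed-zero : ∀ {s} m → NonNeg m → Σ ℚ λ W → TypedMDist (suc s) m W [] × (W ≡ 0ℚ)
typed-zero [] [] = 0ℚ , tnil , Eq.refl
typed-zero ((p , M) ∷ m) (h ∷ hs) with typed-zero m hs
... | W , ts , e = p Q.* 0ℚ Q.+ W , tcons h (⊢zero {M = M}) (s≤s z≤n) ts ,
      Eq.trans (cong₂ Q._+_ (QP.*-zeroʳ p) e) (QP.+-identityˡ 0ℚ)

-- Subject reduction and adequacy

data ValInversion (w : ℚ) (V : Val 0) (a : TDist) (s : ℕ) : Set where
  val-zero : a ≈D [] → w ≡ 0ℚ → ValInversion w V a s
  val-typed : ∀ {Γ : Ctx 0} {𝓜} (e : Γ ⊢I w ∣ V ∶ 𝓜) → a ≈D ((1ℚ , 𝓜) ∷ []) → sizeI e N.≤ s → ValInversion w V a s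

val-inversion : ∀ {Θ : Ctx 0} {w V a} (d : Θ ⊢ w ∣ val V ∶ a) → ValInversion w V a (size d)
val-inversion ⊢zero = val-zero (≈D-refl []) Eq.refl
val-inversion (⊢val e) = val-typed e (≈D-refl _) NP.≤-refl
val-inversion (conv d c a) with val-inversion d
... | val-zero ab w0 = val-zero (≈D-trans (≈D-sym a) ab) w0
... | val-typed e ab le = val-typed e (≈D-trans (≈D-sym a) ab) le

record LamInversion (n : ℕ) (w : ℚ) (M : Tm (suc n)) (𝓜 : Inter) (b : TDist) (s : ℕ) : Set where
  constructor mkLamInversion
  field
    {Γ'} : Ctx n
    {wbody} : ℚ
    d : (𝓜 ∷ Γ') ⊢ wbody ∣ M ∶ b
    wt : w ≡ wbody Q.+ 1ℚ
    lt : suc (size d) N.≤ s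

lam-inversion : ∀ {n} {Γ : Ctx n} {w M A} (dA : Γ ⊢A w ∣ lam M ∶ A) {𝓜 b} → A ≈A (𝓜 ⟶ b) →
  LamInversion n w M 𝓜 b (sizeA dA)
lam-inversion (⊢λ d) (⟶≈ i j) = mkLamInversion (conv d (i VP.∷ ≈C-refl _) j) Eq.refl NP.≤-refl
lam-inversion (convA d c a) eq = lam-inversion d (≈A-trans a eq)

-- s bounds the sizes of the reducts' derivations: the measure of the induction in adequate.
data Reduct (s : ℕ) (N : Tm 0) (v : ℚ) (a : TDist) : Set where
  reduct-zero : a ≈D [] → v ≡ 0ℚ → Reduct s N v a
  reduct-typed : ∀ {W A} → TypedMDist s (stepC N) W A → a ≈D A → v ≤ 1ℚ Q.+ W → Reduct s N v a

subjectReduction-let : ∀ {Γ Θ : Ctx 0} {u vN M c N₁ a} → (dN : Γ ⊢ vN ∣ N₁ ∶ a) →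
  Reduct (size dN) N₁ vN a → (br : Branches Θ u M a c) →
        stepC (letin N₁ M) ≡ mapLet M (stepC N₁) →
        Reduct (suc (size dN N.+ sizeBr br)) (letin N₁ M) (u Q.+ vN Q.+ 1ℚ) c
subjectReduction-let {u = u} {vN} {M} {N₁ = N₁} dN (reduct-zero ab w0) br eq with branches-resp-≈D br ab
... | mkBranches≈ brnil wt cc s≡
  with typed-zero {s = size dN N.+ sizeBr br} (mapLet M (stepC N₁)) (NonNeg-mapLet M (NonNeg-stepC N₁))
... | W , ts , W0 = reduct-typed (Eq.subst (λ z → TypedMDist (suc (size dN N.+ sizeBr br)) z W []) (Eq.sym eq) ts) cc weight≤
  where
  weight≤ : u Q.+ vN Q.+ 1ℚ ≤ 1ℚ Q.+ W
  weight≤ rewrite Eq.sym wt | w0 | W0 = QP.≤-reflexive Eq.refl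
subjectReduction-let {u = u} {vN} {M} {N₁ = N₁} dN (reduct-typed {W} ts aA le) br eq with branches-resp-≈D br aA
... | mkBranches≈ {u' = u'} b' wt cc s≡ with typed-let (sizeBr br) ts b' (NP.≤-reflexive s≡)
... | mkTypedLet {W'} ts' cc' wt' =
  reduct-typed (Eq.subst (λ z → TypedMDist (suc (size dN N.+ sizeBr br)) z W' _) (Eq.sym eq) ts') (≈D-trans cc cc') weight≤
  where
  weight≤ : u Q.+ vN Q.+ 1ℚ ≤ 1ℚ Q.+ W'
  weight≤ = QP.≤-trans (QP.+-monoˡ-≤ 1ℚ (QP.+-monoʳ-≤ u le)) (QP.≤-reflexive weight≡)
    where
    weight≡ : u Q.+ (1ℚ Q.+ W) Q.+ 1ℚ ≡ 1ℚ Q.+ W'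
    weight≡ rewrite wt' | mass-stepC N₁ | wt =
      solve 2 (λ u W → u :+ (con 1ℚ :+ W) :+ con 1ℚ := con 1ℚ :+ (u :+ W :+ con 1ℚ)) Eq.refl u W

subjectReduction-let-val : ∀ {Γ Θ : Ctx 0} {u vN M c V a} → (dN : Γ ⊢ vN ∣ val V ∶ a) →
  (br : Branches Θ u M a c) →
        Reduct (suc (size dN N.+ sizeBr br)) (letin (val V) M) (u Q.+ vN Q.+ 1ℚ) c
subjectReduction-let-val {u = u} {vN} {M} {V = V} dN br with val-inversion dN
... | val-zero ab w0 with branches-resp-≈D br ab
... | mkBranches≈ brnil wt cc s≡ = reduct-typed (tcons (QP.nonNegative⁻¹ 1ℚ) (⊢zero {M = M [ V ]}) (s≤s z≤n) tnil) cc weight≤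
  where
  weight≤ : u Q.+ vN Q.+ 1ℚ ≤ 1ℚ Q.+ (1ℚ Q.* 0ℚ Q.+ 0ℚ)
  weight≤ rewrite Eq.sym wt | w0 = QP.≤-reflexive Eq.refl
subjectReduction-let-val {u = u} {vN} {M} {V = V} dN br | val-typed e ab le with branches-resp-≈D br ab
... | mkBranches≈ (brcons {w = wbr} db brnil) wt cc s≡ with toNormalI e
... | eV , sV with subst⊢ 0 db eV
... | d' , sd' = reduct-typed (tcons (QP.nonNegative⁻¹ 1ℚ) (conv d' (≈C-closed _ []) (≈D-refl _)) size< tnil) cc weight≤
  where
  size< : suc (size d') N.≤ suc (size dN N.+ sizeBr br)
  size< = s≤s (NP.≤-trans sd' (NP.≤-trans (NP.+-mono-≤ (NP.≤-trans (NP.m≤m+n (size db) 0) (NP.≤-reflexive s≡))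
          (NP.≤-trans (NP.≤-reflexive sV) le)) (NP.≤-reflexive (NP.+-comm (sizeBr br) (size dN)))))
  weight≤ : u Q.+ vN Q.+ 1ℚ ≤ 1ℚ Q.+ (1ℚ Q.* (wbr Q.+ vN) Q.+ 0ℚ)
  weight≤ rewrite Eq.sym wt = QP.≤-reflexive (solve 2 (λ x v → con 1ℚ :* x :+ con 0ℚ :+ v :+ con 1ℚ
                                                     := con 1ℚ :+ (con 1ℚ :* (x :+ v) :+ con 0ℚ)) Eq.refl wbr vN)

subjectReduction-β : ∀ {Γ Δ : Ctx 0} {w v M W 𝓜 b} (dV : Γ ⊢I w ∣ lam M ∶ ((1ℚ , (𝓜 ⟶ b)) ∷ [])) (dW : Δ ⊢I v ∣ W ∶ 𝓜) →
  Reduct (sizeI dV N.+ sizeI dW) (app (lam M) W) (w Q.+ v) b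
subjectReduction-β {v = v} {b = b} dV dW with toNormalI dV
... | nbang (lcons {w = wA} _ dA lnil) _ , s≡ with lam-inversion dA (≈A-refl _)
... | mkLamInversion {wbody = wB} db wt lt with toNormalI dW
... | eW , sW with subst⊢ 0 db eW
... | d' , sd' = reduct-typed (tcons (QP.nonNegative⁻¹ 1ℚ) (conv d' (≈C-closed _ []) (≈D-refl _)) size< tnil)
                   (≈D-reflexive (Eq.sym (Eq.trans (++-identityʳ _) (scale-1 b)))) weight≤
  where
  size< : suc (size d') N.≤ sizeI dV N.+ sizeI dW
  size< = NP.≤-trans (s≤s sd') (NP.≤-trans (NP.+-mono-≤ lt (NP.≤-reflexive sW))
         (NP.≤-reflexive (cong (N._+ sizeI dW) (Eq.trans (Eq.sym (NP.+-identityʳ (sizeA dA))) s≡))))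
  weight≤ : 1ℚ Q.* wA Q.+ 0ℚ Q.+ v ≤ 1ℚ Q.+ (1ℚ Q.* (wB Q.+ v) Q.+ 0ℚ)
  weight≤ rewrite wt = QP.≤-reflexive (solve 2 (λ x v → con 1ℚ :* (x :+ con 1ℚ) :+ con 0ℚ :+ v
                                              := con 1ℚ :+ (con 1ℚ :* (x :+ v) :+ con 0ℚ)) Eq.refl wB v)

subjectReduction : ∀ {Θ : Ctx 0} {v N a} → NonValue N → (d : Θ ⊢ v ∣ N ∶ a) → Reduct (size d) N v a
subjectReduction nv ⊢zero = reduct-zero (≈D-refl []) Eq.refl
subjectReduction nv (⊢app {V = var ()} dV dW)
subjectReduction nv (⊢app {V = lam M} dV dW) = subjectReduction-β dV dW
subjectReduction nv (⊢⊕ {w = w₁} {v = w₂} {a = a} {b = b} d₁ d₂) =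
  reduct-typed (tcons (QP.nonNegative⁻¹ ½) (conv d₁ (≈C-closed _ []) (≈D-refl _)) (s≤s (NP.m≤m+n (size d₁) (size d₂)))
        (tcons (QP.nonNegative⁻¹ ½) (conv d₂ (≈C-closed _ []) (≈D-refl _)) (s≤s (NP.m≤n+m (size d₂) (size d₁))) tnil))
      (≈D-reflexive (cong (scaleD ½ a ++_) (Eq.sym (++-identityʳ _))))
      (QP.≤-reflexive (solve 2 (λ a b → con ½ :* a :+ con ½ :* b :+ con 1ℚ
                                    := con 1ℚ :+ (con ½ :* a :+ (con ½ :* b :+ con 0ℚ))) Eq.refl w₁ w₂))
subjectReduction nv (⊢let {N = val V} dN br) = subjectReduction-let-val dN br
subjectReduction nv (⊢let {N = app V W} dN br) = subjectReduction-let dN (subjectReduction nv-app dN) br Eq.refl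
subjectReduction nv (⊢let {N = N₁ ⊕ N₂} dN br) = subjectReduction-let dN (subjectReduction nv-⊕ dN) br Eq.refl
subjectReduction nv (⊢let {N = letin N₁ N₂} dN br) = subjectReduction-let dN (subjectReduction nv-let dN) br Eq.refl
subjectReduction () (⊢val _)
subjectReduction nv (conv d c a) with subjectReduction nv d
... | reduct-zero ab w0 = reduct-zero (≈D-trans (≈D-sym a) ab) w0
... | reduct-typed ts aA le = reduct-typed ts (≈D-trans (≈D-sym a) aA) le

Adequate : ℕ → Set
Adequate s = ∀ {Θ : Ctx 0} {w M b} (d : Θ ⊢ w ∣ M ∶ b) → size d N.< s → Tight b → Attains ((1ℚ , M) ∷ []) w (norm b)

attains-typed : ∀ {s s' m W A} → Adequate s → TypedMDist s' m W A → s' N.≤ s → Tight A → Attains m W (norm A)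
attains-typed IH tnil le t = attains-zero []
attains-typed IH (tcons {p} {M} {w} {a} {m} {W} {A} h d lt ts) le t with Tight-scaleD-++⁻ p a t
... | t₁ , t₂ = attains-weaken QP.≤-refl (QP.≤-reflexive (norm-scaleD-++ p a A))
    (attains-++ (h ∷ []) (NonNeg-typed ts) head (attains-typed IH ts le t₂))
  where
  scaled : Attains (scaleM p ((1ℚ , M) ∷ [])) (p Q.* w) (p Q.* norm a)
  scaled = attains-scaleM h (IH d (NP.≤-trans lt le) t₁)
  head : Attains ((p , M) ∷ []) (p Q.* w) (p Q.* norm a)
  head = Eq.subst (λ z → Attains ((z , M) ∷ []) (p Q.* w) (p Q.* norm a)) (QP.*-identityʳ p) scaled

tight-value : ∀ {Θ : Ctx 0} {w V b} (d : Θ ⊢ w ∣ val V ∶ b) → Tight b → (w ≡ 0ℚ) × (norm b ≤ 1ℚ)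
tight-value d t with val-inversion d
... | val-zero ab w0 = w0 , QP.≤-trans (QP.≤-reflexive (norm-≈ ab)) (QP.nonNegative⁻¹ 1ℚ)
... | val-typed e ab _ with Tight-resp-≈D ab t
... | Eq.refl ∷ [] with toNormalI e
... | e' , _ = proj₂ (normalI-[] e') , QP.≤-reflexive (Eq.trans (norm-≈ ab) (QP.+-identityʳ 1ℚ))

adequate-nonValue : ∀ {s} {Θ : Ctx 0} {w M b} → NonValue M → (d : Θ ⊢ w ∣ M ∶ b) → size d N.< suc s →
  Tight b → Adequate s → Attains ((1ℚ , M) ∷ []) w (norm b)
adequate-nonValue nv d lt t IH with subjectReduction nv d
... | reduct-zero ab Eq.refl = attains-weaken QP.≤-refl (QP.≤-reflexive (norm-≈ ab)) (attains-zero (QP.nonNegative⁻¹ 1ℚ ∷ []))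
... | reduct-typed {W} ts bA le =
  attains-weaken (QP.≤-trans le (QP.≤-reflexive (QP.+-comm 1ℚ W))) (QP.≤-reflexive (norm-≈ bA))
        (attains-step nv (attains-typed IH ts (NP.≤-pred lt) (Tight-resp-≈D bA t)))

adequate : ∀ s → Adequate s
adequate zero d () t
adequate (suc s) {M = val V} d lt t with tight-value d t
... | Eq.refl , nb = attains-weaken QP.≤-refl nb attains-value
adequate (suc s) {M = app V W} d lt t = adequate-nonValue nv-app d lt t (adequate s)
adequate (suc s) {M = M₁ ⊕ M₂} d lt t = adequate-nonValue nv-⊕ d lt t (adequate s)
adequate (suc s) {M = letin N M} d lt t = adequate-nonValue nv-let d lt t (adequate s)

mainTheorem7 : (M : Tm 0) (w : ℚ) (b : TDist) →
    [] ⊢ w ∣ M ∶ b → Tight b →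
    ∃[ k ] ((norm b ≤ 𝒫 k M) × (w ≤ ℰ k M))
mainTheorem7 M w b d t = attains⇒𝒫ℰ M (adequate (suc (size d)) d (NP.n<1+n (size d)) t)
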